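{- Let $PC_n$ be a polygon chain whose stack of polygons has $k_1,\dots,k_n$ sides. Then the sandpile group $K(PC_n)$ is cyclic, of order \[\tau(PC_n)=\sum_{\mu\in M(P_n)}(-1)^{|\mu|}\prod_{v\notin V(\mu)}k_v,\] where $P_n$ is the path with vertices $1,\dots,n$ (in order), $M(P_n)$ is the set of matchings of $P_n$ (including the empty matching), and $V(\mu)$ is the set of vertices covered by $\mu$.
   Context: Polygon chain: let $(k_1,\dots,k_n)$ be integers with each $k_i\geq 2$. $PC_0$ is the path with one edge. For $1\leq i\leq n$, $PC_i$ is obtained from $PC_{i-1}$ by adding a path with $k_i-1$ edges between some pair of adjacent vertices of the path added in the construction of $PC_{i-1}$; thus $PC_n$ is a stack of $n$ polygons with $k_1,\dots,k_n$ sides. $K(G)$ denotes the sandpile group of $G$, i.e. the torsion subgroup of $\mathbb{Z}^{V(G)}/\operatorname{Im}L(G)$ with $L(G)$ the Laplacian matrix, and $\tau(G)$ is the number of spanning trees of $G$. -}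

module Defs where

open import Data.Nat using (ℕ; zero; suc; _∸_; _<_; _≤_)
open import Data.Nat.Base as ℕ using ()
open import Data.Bool using (Bool; true; false; if_then_else_; _∧_; _∨_; not)
open import Data.Fin using (Fin; toℕ; _↑ˡ_; _↑ʳ_; _≟_)
open import Data.Fin.Subset using (Subset; _∈_; ∣_∣) renaming (_-_ to _∖_)
open import Data.Integer as ℤ using (ℤ; +_; -_; _-_; _*_; _+_)
open import Data.List using (List; []; _∷_; _++_; map; foldr; length; lookup; allFin; [_]; concatMap; filter)
open import Data.List.Relation.Unary.All using (All)
open import Data.List.Relation.Unary.Unique.Propositional using (Unique)
import Data.List.Membership.Propositional as LM
open import Data.Vec using (Vec; []; _∷_)
open import Data.Product using (Σ; ∃; _×_; _,_; proj₁; proj₂)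
open import Data.Sum using (_⊎_)
open import Data.Maybe using (Maybe; just; nothing)
open import Relation.Nullary using (¬_; does)
open import Relation.Binary.PropositionalEquality using (_≡_)

record Graph : Set where
  constructor mkGraph
  field
    nv    : ℕ
    edges : List (Fin nv × Fin nv)

open Graph public

sumℤ : List ℤ → ℤ
sumℤ = foldr _+_ (+ 0)

Σℤ : (n : ℕ) → (Fin n → ℤ) → ℤ
Σℤ n f = sumℤ (map f (allFin n))

eqᵇ : {n : ℕ} → Fin n → Fin n → Bool
eqᵇ a b = does (a ≟ b)

ind : Bool → ℤ
ind b = if b then + 1 else + 0

-- adjacency count A v w (a loop at v counts twice in A v v), degree, Laplacian L = D - A
adjCount : (G : Graph) → Fin (nv G) → Fin (nv G) → ℤ
adjCount G v w = sumℤ (map (λ e → ind (eqᵇ (proj₁ e) v ∧ eqᵇ (proj₂ e) w)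
                                 + ind (eqᵇ (proj₁ e) w ∧ eqᵇ (proj₂ e) v)) (edges G))

degree : (G : Graph) → Fin (nv G) → ℤ
degree G v = sumℤ (map (λ e → ind (eqᵇ (proj₁ e) v) + ind (eqᵇ (proj₂ e) v)) (edges G))

laplacian : (G : Graph) → Fin (nv G) → Fin (nv G) → ℤ
laplacian G v w = (if eqᵇ v w then degree G v else + 0) - adjCount G v w

-- Sandpile group K(G) = torsion subgroup of ℤ^V / Im L(G), handled via
-- representatives in ℤ^V = (Fin nv → ℤ) and membership in Im L(G).

Config : Graph → Set
Config G = Fin (nv G) → ℤ

InImL : (G : Graph) → Config G → Set
InImL G x = Σ (Config G) λ z → ∀ v → x v ≡ Σℤ (nv G) (λ w → laplacian G v w * z w)

_≈[_]_ : {G : Graph} → Config G → (H : Graph) → Config G → Set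
_≈[_]_ {G} x _ y = InImL G (λ v → x v - y v)

scale : (G : Graph) → ℤ → Config G → Config G
scale G c x v = c * x v

IsTorsion : (G : Graph) → Config G → Set
IsTorsion G x = Σ ℕ λ m → (1 ≤ m) × InImL G (scale G (+ m) x)

SandpileCyclicOfOrder : Graph → ℕ → Set
SandpileCyclicOfOrder G N =
  Σ (Config G) λ g →
    IsTorsion G g
  × (∀ x → IsTorsion G x → Σ ℤ λ c → _≈[_]_ {G} x G (scale G c g))
  × (1 ≤ N)
  × InImL G (scale G (+ N) g)
  × (∀ m → 1 ≤ m → m < N → ¬ InImL G (scale G (+ m) g))

-- Spanning trees: subsets of the edge list (indexed by Fin (length edges)).

EdgeSet : Graph → Set
EdgeSet G = Subset (length (edges G))

data Reach (G : Graph) (S : EdgeSet G) (u : Fin (nv G)) : Fin (nv G) → Set where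
  here : Reach G S u u
  fwd  : (e : Fin (length (edges G))) → e ∈ S →
         Reach G S u (proj₁ (lookup (edges G) e)) → Reach G S u (proj₂ (lookup (edges G) e))
  bwd  : (e : Fin (length (edges G))) → e ∈ S →
         Reach G S u (proj₂ (lookup (edges G) e)) → Reach G S u (proj₁ (lookup (edges G) e))

Connected : (G : Graph) → EdgeSet G → Set
Connected G S = ∀ u v → Reach G S u v

IsSpanningTree : (G : Graph) → EdgeSet G → Set
IsSpanningTree G S = Connected G S × (∀ e → e ∈ S → ¬ Connected G (S ∖ e))

NumSpanningTrees : Graph → ℕ → Set
NumSpanningTrees G N =
  Σ (List (EdgeSet G)) λ ts →
    Unique ts × All (IsSpanningTree G) ts
  × (∀ S → IsSpanningTree G S → S LM.∈ ts) × length ts ≡ N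

record PCState : Set where
  constructor mkPC
  field
    graph : Graph
    path  : List (Fin (nv graph))   -- vertices (in order) of the most recently added path

open PCState public

consecPairs : {A : Set} → List A → List (A × A)
consecPairs (a ∷ b ∷ r) = (a , b) ∷ consecPairs (b ∷ r)
consecPairs _ = []

adjPair : {A : Set} → List A → ℕ → Maybe (A × A)
adjPair (a ∷ b ∷ r) zero = just (a , b)
adjPair (a ∷ r) (suc j) = adjPair r j
adjPair _ _ = nothing

pc0 : PCState
pc0 = mkPC (mkGraph 2 ((F.zero , F.suc F.zero) ∷ [])) (F.zero ∷ F.suc F.zero ∷ [])
  where module F = Data.Fin

-- add a path with k-1 edges (k-2 new internal vertices) between u and w
addPath : (P : PCState) → Fin (nv (graph P)) → Fin (nv (graph P)) → ℕ → PCState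
addPath P u w k =
  mkPC (mkGraph (n ℕ.+ m) (map inj (edges (graph P)) ++ consecPairs newPath)) newPath
  where
    n = nv (graph P)
    m = k ∸ 2
    inj : Fin n × Fin n → Fin (n ℕ.+ m) × Fin (n ℕ.+ m)
    inj (a , b) = a ↑ˡ m , b ↑ˡ m
    newPath : List (Fin (n ℕ.+ m))
    newPath = (u ↑ˡ m) ∷ (map (n ↑ʳ_) (allFin m) ++ [ w ↑ˡ m ])

data IsPolygonChain : List ℕ → PCState → Set where
  base : IsPolygonChain [] pc0
  step : ∀ {ks P} (k j : ℕ) {u w} → IsPolygonChain ks P →
         adjPair (path P) j ≡ just (u , w) →
         IsPolygonChain (ks ++ [ k ]) (addPath P u w k)

-- Matchings of the path P_n (vertices 0,…,n-1; edge i = {i, i+1}, i < n-1).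

allSubsets : (m : ℕ) → List (Subset m)
allSubsets zero = [] ∷ []
allSubsets (suc m) = concatMap (λ s → (true ∷ s) ∷ (false ∷ s) ∷ []) (allSubsets m)

memᵇ : {m : ℕ} → Fin m → Subset m → Bool
memᵇ Data.Fin.zero (b ∷ _) = b
memᵇ (Data.Fin.suc i) (_ ∷ s) = memᵇ i s

allᵇ : {A : Set} → (A → Bool) → List A → Bool
allᵇ p = foldr (λ a r → p a ∧ r) true

anyᵇ : {A : Set} → (A → Bool) → List A → Bool
anyᵇ p = foldr (λ a r → p a ∨ r) false

ℕeqᵇ : ℕ → ℕ → Bool
ℕeqᵇ a b = does (a Data.Nat.≟ b)

disjointEdgesᵇ : ℕ → ℕ → Bool
disjointEdgesᵇ i j = not (ℕeqᵇ i j ∨ ℕeqᵇ i (suc j) ∨ ℕeqᵇ (suc i) j ∨ ℕeqᵇ (suc i) (suc j))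

isMatchingᵇ : {m : ℕ} → Subset m → Bool
isMatchingᵇ {m} μ = allᵇ (λ i → allᵇ (λ j →
    not (memᵇ i μ ∧ memᵇ j μ ∧ not (eqᵇ i j)) ∨ disjointEdgesᵇ (toℕ i) (toℕ j))
  (allFin m)) (allFin m)

matchingsOfPath : (n : ℕ) → List (Subset (n ∸ 1))
matchingsOfPath n = filter (λ μ → Data.Bool._≟_ (isMatchingᵇ μ) true) (allSubsets (n ∸ 1))

coveredᵇ : {m : ℕ} → Subset m → ℕ → Bool
coveredᵇ {m} μ v = anyᵇ (λ i → memᵇ i μ ∧ (ℕeqᵇ (toℕ i) v ∨ ℕeqᵇ (suc (toℕ i)) v)) (allFin m)

prodℤ : List ℤ → ℤ
prodℤ = foldr _*_ (+ 1)

signℤ : ℕ → ℤ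
signℤ zero = + 1
signℤ (suc n) = - signℤ n

matchingFormula : List ℕ → ℤ
matchingFormula ks =
  sumℤ (map (λ μ → signℤ ∣ μ ∣ *
                   prodℤ (map (λ v → if coveredᵇ μ (toℕ v) then + 1 else + (lookup ks v))
                              (allFin (length ks))))
            (matchingsOfPath (length ks)))

module Submission where

-- One induction along the construction of PC_n tracks
--   a = number of spanning trees,  b = number of those through a fixed edge
-- of the path added last.  Gluing a path of m+1 edges (a (m+2)-gon) on such an
-- edge gives a' = (m+1) a + b and b' = m a + b: a new spanning tree omits one
-- new edge (any old tree), or keeps the whole path instead of the glued edge.
-- The same (a, b) control the sandpile group: g = δ_{q₁} - δ_{q₀} (first edge
-- of the new path) generates all degree-0 classes, and a potential H with
-- L H = a (δ_{q₀} - δ_{q₁}), H q₀ - H q₁ = b, gcd(a, b) = 1, shows g has order a.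
-- Finally (a, a - b) follow the continuant recursion, as does the matching
-- formula of the path.

open import Defs
open import Data.Nat as ℕ using (ℕ; zero; suc; _<_; _≤_; z≤n; s≤s; _∸_; _≡ᵇ_)
import Data.Nat.Properties as ℕP
import Data.Nat.Tactic.RingSolver as ℕSolver
open import Data.Nat.Divisibility using (_∣_; divides; ∣⇒≤; ∣m+n∣m⇒∣n; ∣n⇒∣m*n; ∣1⇒≡1)
open import Data.Nat.Coprimality using (Coprime; coprime-divisor)
open import Data.Nat.ListAction using (sum)
open import Data.Bool as Bool using (Bool; true; false; if_then_else_; _∧_; _∨_; not)
import Data.Bool.Properties as BoolP
open import Data.Fin as F using (Fin; toℕ; _↑ˡ_; _↑ʳ_; splitAt)
import Data.Fin.Properties as FP
open import Data.Fin.Subset using (Subset; _∈_; ∣_∣) renaming (_-_ to _∖_)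
open import Data.Integer as ℤ using (ℤ; +_; -_; _-_; _*_; _+_; +0)
import Data.Integer.Properties as ℤP
open import Data.Integer.Tactic.RingSolver using (solve-∀)
open import Data.List using (List; []; _∷_; _++_; [_]; map; length; lookup; allFin; tabulate; filter; concat; concatMap)
import Data.List.Properties as LP
import Data.List.Membership.Propositional as LM
import Data.List.Membership.Propositional.Properties as LMP
import Data.List.Relation.Unary.Any as Any
open import Data.List.Relation.Unary.All as All using (All; []; _∷_)
import Data.List.Relation.Unary.All.Properties as AllP
open import Data.List.Relation.Unary.AllPairs as AllPairs using (AllPairs)
import Data.List.Relation.Unary.AllPairs.Properties as AllPairsP
open import Data.List.Relation.Unary.Unique.Propositional using (Unique)
import Data.List.Relation.Unary.Unique.Propositional.Properties as UniqueP
open import Data.List.Relation.Binary.Disjoint.Propositional using (Disjoint)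
open import Data.Vec as V using (Vec; []; _∷_)
import Data.Vec.Properties as VP
open import Data.Product using (Σ; _×_; _,_; proj₁; proj₂)
open import Data.Sum as Sum using (_⊎_; inj₁; inj₂; [_,_]′)
import Data.Sum.Properties as SumP
open import Data.Maybe using (just)
open import Data.Empty using (⊥; ⊥-elim)
open import Relation.Nullary using (¬_; Dec; does; yes; no)
open import Relation.Nullary.Decidable using (dec-true; dec-false; does-≡; map′; ¬?; _×-dec_)
open import Relation.Binary.Definitions using (Tri; tri<; tri≈; tri>)
open import Relation.Binary.PropositionalEquality
  using (_≡_; _≢_; refl; sym; trans; cong; cong₂; subst; subst₂; module ≡-Reasoning)

∑ : {A : Set} → (A → ℤ) → List A → ℤ
∑ f l = sumℤ (map f l)

module _ {A : Set} where

  ∑-cong : (l : List A) {f g : A → ℤ} → (∀ x → f x ≡ g x) → ∑ f l ≡ ∑ g l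
  ∑-cong [] eq = refl
  ∑-cong (x ∷ l) eq = cong₂ _+_ (eq x) (∑-cong l eq)

  ∑-+ : (l : List A) (f g : A → ℤ) → ∑ (λ x → f x + g x) l ≡ ∑ f l + ∑ g l
  ∑-+ [] f g = refl
  ∑-+ (x ∷ l) f g = trans (cong (_+_ (f x + g x)) (∑-+ l f g)) (interchange (f x) (g x) _ _)
    where
    interchange : ∀ a b c d → a + b + (c + d) ≡ a + c + (b + d)
    interchange = solve-∀

  ∑-- : (l : List A) (f g : A → ℤ) → ∑ (λ x → f x - g x) l ≡ ∑ f l - ∑ g l
  ∑-- [] f g = refl
  ∑-- (x ∷ l) f g = trans (cong (_+_ (f x - g x)) (∑-- l f g)) (interchange (f x) (g x) _ _)
    where
    interchange : ∀ a b c d → a - b + (c - d) ≡ a + c - (b + d)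
    interchange = solve-∀

  ∑-*ˡ : (l : List A) (c : ℤ) (f : A → ℤ) → ∑ (λ x → c * f x) l ≡ c * ∑ f l
  ∑-*ˡ [] c f = sym (ℤP.*-zeroʳ c)
  ∑-*ˡ (x ∷ l) c f = trans (cong (_+_ (c * f x)) (∑-*ˡ l c f)) (sym (ℤP.*-distribˡ-+ c (f x) _))

  ∑-0 : (l : List A) → ∑ (λ _ → +0) l ≡ +0
  ∑-0 [] = refl
  ∑-0 (x ∷ l) = trans (ℤP.+-identityˡ _) (∑-0 l)

  ∑-++ : (l₁ l₂ : List A) (f : A → ℤ) → ∑ f (l₁ ++ l₂) ≡ ∑ f l₁ + ∑ f l₂
  ∑-++ [] l₂ f = sym (ℤP.+-identityˡ _)
  ∑-++ (x ∷ l₁) l₂ f = trans (cong (_+_ (f x)) (∑-++ l₁ l₂ f)) (sym (ℤP.+-assoc (f x) _ _))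

∑-map : {A B : Set} (l : List A) (g : A → B) (f : B → ℤ) → ∑ f (map g l) ≡ ∑ (λ x → f (g x)) l
∑-map [] g f = refl
∑-map (x ∷ l) g f = cong (_+_ (f (g x))) (∑-map l g f)

∑-swap : {A B : Set} (l₁ : List A) (l₂ : List B) (f : A → B → ℤ) →
  ∑ (λ x → ∑ (f x) l₂) l₁ ≡ ∑ (λ y → ∑ (λ x → f x y) l₁) l₂
∑-swap [] l₂ f = sym (∑-0 l₂)
∑-swap (x ∷ l₁) l₂ f =
  trans (cong (_+_ (∑ (f x) l₂)) (∑-swap l₁ l₂ f)) (sym (∑-+ l₂ (f x) (λ y → ∑ (λ x → f x y) l₁)))

eqᵇ-refl : {n : ℕ} (a : Fin n) → eqᵇ a a ≡ true
eqᵇ-refl a = dec-true (a F.≟ a) refl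

eqᵇ-false : {n : ℕ} {a b : Fin n} → a ≢ b → eqᵇ a b ≡ false
eqᵇ-false {a = a} {b} = dec-false (a F.≟ b)

eqᵇ-sym : {n : ℕ} (a b : Fin n) → eqᵇ a b ≡ eqᵇ b a
eqᵇ-sym a b = does-≡ (a F.≟ b) (map′ sym sym (b F.≟ a))

eqᵇ-inj : {a b : ℕ} (f : Fin a → Fin b) → (∀ {x y} → f x ≡ f y → x ≡ y) →
  ∀ x y → eqᵇ (f x) (f y) ≡ eqᵇ x y
eqᵇ-inj f inj x y with x F.≟ y
... | yes refl = eqᵇ-refl (f x)
... | no x≢y = eqᵇ-false (λ eq → x≢y (inj eq))

δ : {n : ℕ} → Fin n → Fin n → ℤ
δ a v = ind (eqᵇ a v)

ind-∧ : (b c : Bool) → ind (b ∧ c) ≡ ind b * ind c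
ind-∧ true c = sym (ℤP.*-identityˡ _)
ind-∧ false c = refl

Σℤ-cong : (n : ℕ) {f g : Fin n → ℤ} → (∀ x → f x ≡ g x) → Σℤ n f ≡ Σℤ n g
Σℤ-cong n = ∑-cong (allFin n)

Σℤ-δ : (n : ℕ) (a : Fin n) (f : Fin n → ℤ) → Σℤ n (λ w → δ a w * f w) ≡ f a
Σℤ-δ (suc n) a f = trans (cong (_+_ (δ a F.zero * f F.zero)) allFin-suc) (split a)
  where
  allFin-suc : ∑ (λ w → δ a w * f w) (tabulate F.suc) ≡ ∑ (λ w → δ a (F.suc w) * f (F.suc w)) (allFin n)
  allFin-suc = trans (cong (∑ (λ w → δ a w * f w)) (sym (LP.map-tabulate (λ x → x) F.suc)))
                     (∑-map (allFin n) F.suc (λ w → δ a w * f w))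
  split : ∀ a → δ a F.zero * f F.zero + ∑ (λ w → δ a (F.suc w) * f (F.suc w)) (allFin n) ≡ f a
  split F.zero = trans (cong₂ _+_ (ℤP.*-identityˡ (f F.zero))
                                  (trans (∑-cong (allFin n) (λ w → ℤP.*-zeroˡ (f (F.suc w)))) (∑-0 (allFin n))))
                       (ℤP.+-identityʳ _)
  split (F.suc a) = trans (ℤP.+-identityˡ _) (Σℤ-δ n a (λ w → f (F.suc w)))

Σr : ℕ → (ℕ → ℤ) → ℤ
Σr zero f = +0
Σr (suc M) f = f 0 + Σr M (λ i → f (suc i))

Σr-cong : ∀ M {f g : ℕ → ℤ} → (∀ i → i < M → f i ≡ g i) → Σr M f ≡ Σr M g
Σr-cong zero eq = refl
Σr-cong (suc M) eq = cong₂ _+_ (eq 0 (s≤s z≤n)) (Σr-cong M (λ i p → eq (suc i) (s≤s p)))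

Σr-+ : ∀ M (f g : ℕ → ℤ) → Σr M (λ i → f i + g i) ≡ Σr M f + Σr M g
Σr-+ zero f g = refl
Σr-+ (suc M) f g = trans (cong (_+_ (f 0 + g 0)) (Σr-+ M (λ i → f (suc i)) (λ i → g (suc i)))) (interchange (f 0) (g 0) _ _)
  where
  interchange : ∀ a b c d → a + b + (c + d) ≡ a + c + (b + d)
  interchange = solve-∀

Σr-* : ∀ M (c : ℤ) (f : ℕ → ℤ) → Σr M (λ i → c * f i) ≡ c * Σr M f
Σr-* zero c f = sym (ℤP.*-zeroʳ c)
Σr-* (suc M) c f = trans (cong (_+_ (c * f 0)) (Σr-* M c (λ i → f (suc i)))) (sym (ℤP.*-distribˡ-+ c (f 0) _))

Σr-- : ∀ M (f g : ℕ → ℤ) → Σr M (λ i → f i - g i) ≡ Σr M f - Σr M g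
Σr-- M f g = trans (Σr-+ M f (λ i → - g i)) (cong (_+_ (Σr M f)) negate)
  where
  negate : Σr M (λ i → - g i) ≡ - Σr M g
  negate = trans (Σr-cong M (λ i _ → sym (ℤP.-1*i≡-i (g i)))) (trans (Σr-* M (- + 1) g) (ℤP.-1*i≡-i _))

Σr-const : ∀ M c → Σr M (λ _ → c) ≡ + M * c
Σr-const zero c = sym (ℤP.*-zeroˡ c)
Σr-const (suc M) c = trans (cong (_+_ (c)) (Σr-const M c)) (lemma c (+ M))
  where
  lemma : ∀ c x → c + x * c ≡ (+ 1 + x) * c
  lemma = solve-∀

Σr-telescope : ∀ M (f : ℕ → ℤ) → Σr M (λ i → f i - f (suc i)) ≡ f 0 - f M
Σr-telescope zero f = sym (ℤP.+-inverseʳ (f 0))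
Σr-telescope (suc M) f = trans (cong (_+_ (f 0 - f 1)) (Σr-telescope M (λ i → f (suc i)))) (lemma (f 0) (f 1) (f (suc M)))
  where
  lemma : ∀ a b c → a - b + (b - c) ≡ a - c
  lemma = solve-∀

Σr-pick : ∀ M j (f : ℕ → ℤ) → j < M → Σr M (λ i → ind (i ≡ᵇ j) * f i) ≡ f j
Σr-pick (suc M) zero f p =
  trans (cong₂ _+_ (ℤP.*-identityˡ (f 0)) (trans (Σr-cong M (λ i _ → ℤP.*-zeroˡ (f (suc i)))) (Σr-const M +0)))
        (trans (cong (_+_ (f 0)) (ℤP.*-zeroʳ (+ M))) (ℤP.+-identityʳ _))
Σr-pick (suc M) (suc j) f (s≤s p) = trans (ℤP.+-identityˡ _) (Σr-pick M j (λ i → f (suc i)) p)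

-- The Laplacian as a sum over edges:  (L z)(v) = Σ_{e=(a,b)} (z a - z b)(δ_a v - δ_b v).
-- Every computation with Laplacians below goes through this form.

edgeLaplacian : (G : Graph) → Config G → Config G
edgeLaplacian G z v = ∑ (λ e → (z (proj₁ e) - z (proj₂ e)) * (δ (proj₁ e) v - δ (proj₂ e) v)) (edges G)

δ-subst : {n : ℕ} (a v : Fin n) (f : Fin n → ℤ) → δ a v * f v ≡ δ a v * f a
δ-subst a v f with a F.≟ v
... | yes refl = refl
... | no _ = refl

module _ (G : Graph) (z : Config G) (v : Fin (nv G)) where
  private
    n : ℕ
    n = nv G
    ι₁ ι₂ : Fin n × Fin n → ℤ
    ι₁ e = δ (proj₁ e) v
    ι₂ e = δ (proj₂ e) v

  degreePart : Σℤ n (λ w → (if eqᵇ v w then degree G v else +0) * z w) ≡ ∑ (λ e → (ι₁ e + ι₂ e) * z v) (edges G)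
  degreePart = begin
      Σℤ n (λ w → (if eqᵇ v w then degree G v else +0) * z w)
    ≡⟨ Σℤ-cong n (λ w → asDelta (eqᵇ v w) (z w)) ⟩
      Σℤ n (λ w → δ v w * (degree G v * z w))
    ≡⟨ Σℤ-δ n v (λ w → degree G v * z w) ⟩
      degree G v * z v
    ≡⟨ trans (ℤP.*-comm (degree G v) (z v)) (sym (∑-*ˡ (edges G) (z v) (λ e → ι₁ e + ι₂ e))) ⟩
      ∑ (λ e → z v * (ι₁ e + ι₂ e)) (edges G)
    ≡⟨ ∑-cong (edges G) (λ e → ℤP.*-comm (z v) _) ⟩
      ∑ (λ e → (ι₁ e + ι₂ e) * z v) (edges G)
    ∎
    where
    open ≡-Reasoning
    asDelta : ∀ b x → (if b then degree G v else +0) * x ≡ ind b * (degree G v * x)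
    asDelta true x = sym (ℤP.*-identityˡ _)
    asDelta false x = refl

  adjacencyPart : Σℤ n (λ w → adjCount G v w * z w) ≡ ∑ (λ e → ι₁ e * z (proj₂ e) + z (proj₁ e) * ι₂ e) (edges G)
  adjacencyPart = begin
      Σℤ n (λ w → adjCount G v w * z w)
    ≡⟨ Σℤ-cong n (λ w → trans (ℤP.*-comm (adjCount G v w) (z w)) (sym (∑-*ˡ (edges G) (z w) (incidence w)))) ⟩
      ∑ (λ w → ∑ (λ e → z w * incidence w e) (edges G)) (allFin n)
    ≡⟨ ∑-swap (allFin n) (edges G) _ ⟩
      ∑ (λ e → Σℤ n (λ w → z w * incidence w e)) (edges G)
    ≡⟨ ∑-cong (edges G) perEdge ⟩
      ∑ (λ e → ι₁ e * z (proj₂ e) + z (proj₁ e) * ι₂ e) (edges G)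
    ∎
    where
    open ≡-Reasoning
    incidence : Fin n → Fin n × Fin n → ℤ
    incidence w e = ind (eqᵇ (proj₁ e) v ∧ eqᵇ (proj₂ e) w) + ind (eqᵇ (proj₁ e) w ∧ eqᵇ (proj₂ e) v)
    perEdge : ∀ e → Σℤ n (λ w → z w * incidence w e) ≡ ι₁ e * z (proj₂ e) + z (proj₁ e) * ι₂ e
    perEdge (a , b) = begin
        Σℤ n (λ w → z w * incidence w (a , b))
      ≡⟨ Σℤ-cong n (λ w → trans (cong (z w *_) (cong₂ _+_ (ind-∧ (eqᵇ a v) (eqᵇ b w)) (ind-∧ (eqᵇ a w) (eqᵇ b v))))
                                (regroup (z w) (δ a v) (δ b w) (δ a w) (δ b v))) ⟩
        Σℤ n (λ w → δ b w * (δ a v * z w) + δ a w * (z w * δ b v))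
      ≡⟨ ∑-+ (allFin n) _ _ ⟩
        Σℤ n (λ w → δ b w * (δ a v * z w)) + Σℤ n (λ w → δ a w * (z w * δ b v))
      ≡⟨ cong₂ _+_ (Σℤ-δ n b (λ w → δ a v * z w)) (Σℤ-δ n a (λ w → z w * δ b v)) ⟩
        δ a v * z b + z a * δ b v
      ∎
      where
      regroup : ∀ x p q r s → x * (p * q + r * s) ≡ q * (p * x) + r * (x * s)
      regroup = solve-∀

  perEdgeLaplacian : ∀ e → (ι₁ e + ι₂ e) * z v - (ι₁ e * z (proj₂ e) + z (proj₁ e) * ι₂ e)
                           ≡ (z (proj₁ e) - z (proj₂ e)) * (δ (proj₁ e) v - δ (proj₂ e) v)
  perEdgeLaplacian (a , b) =
    trans (cong (_- (δ a v * z b + z a * δ b v))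
                (trans (ℤP.*-distribʳ-+ (z v) (δ a v) (δ b v)) (cong₂ _+_ (δ-subst a v z) (δ-subst b v z))))
          (regroup (δ a v) (δ b v) (z a) (z b))
    where
    regroup : ∀ p q x y → (p * x + q * y) - (p * y + x * q) ≡ (x - y) * (p - q)
    regroup = solve-∀

  laplacian≡edgeLaplacian : Σℤ n (λ w → laplacian G v w * z w) ≡ edgeLaplacian G z v
  laplacian≡edgeLaplacian = begin
      Σℤ n (λ w → laplacian G v w * z w)
    ≡⟨ Σℤ-cong n (λ w → distrib (if eqᵇ v w then degree G v else +0) (adjCount G v w) (z w)) ⟩
      Σℤ n (λ w → (if eqᵇ v w then degree G v else +0) * z w - adjCount G v w * z w)
    ≡⟨ ∑-- (allFin n) _ _ ⟩
      Σℤ n (λ w → (if eqᵇ v w then degree G v else +0) * z w) - Σℤ n (λ w → adjCount G v w * z w)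
    ≡⟨ cong₂ _-_ degreePart adjacencyPart ⟩
      ∑ (λ e → (ι₁ e + ι₂ e) * z v) (edges G) - ∑ (λ e → ι₁ e * z (proj₂ e) + z (proj₁ e) * ι₂ e) (edges G)
    ≡⟨ sym (∑-- (edges G) _ _) ⟩
      ∑ (λ e → (ι₁ e + ι₂ e) * z v - (ι₁ e * z (proj₂ e) + z (proj₁ e) * ι₂ e)) (edges G)
    ≡⟨ ∑-cong (edges G) perEdgeLaplacian ⟩
      edgeLaplacian G z v
    ∎
    where
    open ≡-Reasoning
    distrib : ∀ a b c → (a - b) * c ≡ a * c - b * c
    distrib = solve-∀

InIm : (G : Graph) → Config G → Set
InIm G x = Σ (Config G) λ z → ∀ v → x v ≡ edgeLaplacian G z v

module _ (G : Graph) where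
  private
    n : ℕ
    n = nv G
    es : List (Fin n × Fin n)
    es = edges G

  InIm⇒InImL : ∀ {x} → InIm G x → InImL G x
  InIm⇒InImL (z , p) = z , λ v → trans (p v) (sym (laplacian≡edgeLaplacian G z v))

  InImL⇒InIm : ∀ {x} → InImL G x → InIm G x
  InImL⇒InIm (z , p) = z , λ v → trans (p v) (laplacian≡edgeLaplacian G z v)

  edgeLaplacian-+ : ∀ (z₁ z₂ : Config G) v → edgeLaplacian G (λ y → z₁ y + z₂ y) v ≡ edgeLaplacian G z₁ v + edgeLaplacian G z₂ v
  edgeLaplacian-+ z₁ z₂ v = trans (∑-cong es (λ e → distrib (z₁ (proj₁ e)) (z₁ (proj₂ e)) (z₂ (proj₁ e)) (z₂ (proj₂ e)) _)) (∑-+ es _ _)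
    where
    distrib : ∀ a₁ a₂ b₁ b₂ d → ((a₁ + b₁) - (a₂ + b₂)) * d ≡ (a₁ - a₂) * d + (b₁ - b₂) * d
    distrib = solve-∀

  edgeLaplacian-* : ∀ (c : ℤ) (z : Config G) v → edgeLaplacian G (λ y → c * z y) v ≡ c * edgeLaplacian G z v
  edgeLaplacian-* c z v = trans (∑-cong es (λ e → distrib c (z (proj₁ e)) (z (proj₂ e)) _)) (∑-*ˡ es c _)
    where
    distrib : ∀ c a b d → (c * a - c * b) * d ≡ c * ((a - b) * d)
    distrib = solve-∀

  edgeLaplacian-0 : ∀ v → edgeLaplacian G (λ _ → +0) v ≡ +0
  edgeLaplacian-0 v = trans (∑-cong es (λ e → ℤP.*-zeroˡ (δ (proj₁ e) v - δ (proj₂ e) v))) (∑-0 es)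

  InIm-resp : ∀ {x y : Config G} → (∀ v → x v ≡ y v) → InIm G x → InIm G y
  InIm-resp eq (z , p) = z , λ v → trans (sym (eq v)) (p v)

  InIm-0 : InIm G (λ _ → +0)
  InIm-0 = (λ _ → +0) , λ v → sym (edgeLaplacian-0 v)

  InIm-+ : ∀ {x y} → InIm G x → InIm G y → InIm G (λ v → x v + y v)
  InIm-+ (z₁ , p₁) (z₂ , p₂) = (λ y → z₁ y + z₂ y) , λ v → trans (cong₂ _+_ (p₁ v) (p₂ v)) (sym (edgeLaplacian-+ z₁ z₂ v))

  InIm-* : ∀ c {x} → InIm G x → InIm G (λ v → c * x v)
  InIm-* c (z , p) = (λ y → c * z y) , λ v → trans (cong (c *_) (p v)) (sym (edgeLaplacian-* c z v))

  InIm-∑ : {A : Set} (l : List A) (f : A → Config G) → (∀ a → InIm G (f a)) → InIm G (λ v → ∑ (λ a → f a v) l)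
  InIm-∑ [] f h = InIm-0
  InIm-∑ (a ∷ l) f h = InIm-+ (h a) (InIm-∑ l f h)

  Σℤ-δʳ : ∀ (a : Fin n) (C : Config G) → Σℤ n (λ v → C v * δ a v) ≡ C a
  Σℤ-δʳ a C = trans (Σℤ-cong n (λ w → ℤP.*-comm (C w) (δ a w))) (Σℤ-δ n a C)

  -- every element of Im L has total degree 0 (the columns of L sum to 0)
  degree-image : ∀ z → Σℤ n (edgeLaplacian G z) ≡ +0
  degree-image z = trans (∑-swap (allFin n) es (λ v e → term e v)) (trans (∑-cong es perEdge) (∑-0 es))
    where
    term : Fin n × Fin n → Fin n → ℤ
    term e v = (z (proj₁ e) - z (proj₂ e)) * (δ (proj₁ e) v - δ (proj₂ e) v)
    Σδ : ∀ a → Σℤ n (δ a) ≡ + 1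
    Σδ a = trans (Σℤ-cong n (λ w → sym (ℤP.*-identityʳ (δ a w)))) (Σℤ-δ n a (λ _ → + 1))
    perEdge : ∀ e → Σℤ n (term e) ≡ +0
    perEdge (a , b) = trans (∑-*ˡ (allFin n) (z a - z b) (λ v → δ a v - δ b v))
      (trans (cong ((z a - z b) *_) (trans (∑-- (allFin n) (δ a) (δ b)) (trans (cong₂ _-_ (Σδ a) (Σδ b)) refl)))
             (ℤP.*-zeroʳ (z a - z b)))

  dirichlet : ∀ (C z : Config G) → Σℤ n (λ v → C v * edgeLaplacian G z v)
                                    ≡ ∑ (λ e → (C (proj₁ e) - C (proj₂ e)) * (z (proj₁ e) - z (proj₂ e))) es
  dirichlet C z = trans (Σℤ-cong n (λ v → sym (∑-*ˡ es (C v) _))) (trans (∑-swap (allFin n) es _) (∑-cong es perEdge))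
    where
    perEdge : ∀ e → Σℤ n (λ v → C v * ((z (proj₁ e) - z (proj₂ e)) * (δ (proj₁ e) v - δ (proj₂ e) v)))
                    ≡ (C (proj₁ e) - C (proj₂ e)) * (z (proj₁ e) - z (proj₂ e))
    perEdge (a , b) = begin
        Σℤ n (λ v → C v * ((z a - z b) * (δ a v - δ b v)))
      ≡⟨ Σℤ-cong n (λ v → regroup (C v) (z a - z b) (δ a v) (δ b v)) ⟩
        Σℤ n (λ v → (z a - z b) * (C v * δ a v - C v * δ b v))
      ≡⟨ ∑-*ˡ (allFin n) (z a - z b) _ ⟩
        (z a - z b) * Σℤ n (λ v → C v * δ a v - C v * δ b v)
      ≡⟨ cong ((z a - z b) *_) (trans (∑-- (allFin n) _ _) (cong₂ _-_ (Σℤ-δʳ a C) (Σℤ-δʳ b C))) ⟩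
        (z a - z b) * (C a - C b)
      ≡⟨ ℤP.*-comm (z a - z b) (C a - C b) ⟩
        (C a - C b) * (z a - z b)
      ∎
      where
      open ≡-Reasoning
      regroup : ∀ c y d₁ d₂ → c * (y * (d₁ - d₂)) ≡ y * (c * d₁ - c * d₂)
      regroup = solve-∀

  laplacian-symmetric : ∀ (C z : Config G) → Σℤ n (λ v → C v * edgeLaplacian G z v) ≡ Σℤ n (λ v → z v * edgeLaplacian G C v)
  laplacian-symmetric C z =
    trans (dirichlet C z) (trans (∑-cong es (λ e → ℤP.*-comm (C (proj₁ e) - C (proj₂ e)) _)) (sym (dirichlet z C)))

  degree0-decomposition : ∀ (x : Config G) (r : Fin n) → Σℤ n x ≡ +0 →
    ∀ y → x y ≡ Σℤ n (λ v → x v * (δ v y - δ r y))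
  degree0-decomposition x r deg0 y = sym (begin
      Σℤ n (λ v → x v * (δ v y - δ r y))
    ≡⟨ Σℤ-cong n (λ v → distrib (x v) (δ v y) (δ r y)) ⟩
      Σℤ n (λ v → x v * δ v y - x v * δ r y)
    ≡⟨ ∑-- (allFin n) _ _ ⟩
      Σℤ n (λ v → x v * δ v y) - Σℤ n (λ v → x v * δ r y)
    ≡⟨ cong₂ _-_ (trans (Σℤ-cong n (λ v → cong (λ b → x v * ind b) (eqᵇ-sym v y))) (Σℤ-δʳ y x)) baseTerm ⟩
      x y - +0
    ≡⟨ ℤP.+-identityʳ (x y) ⟩
      x y
    ∎)
    where
    open ≡-Reasoning
    distrib : ∀ a b c → a * (b - c) ≡ a * b - a * c
    distrib = solve-∀
    baseTerm : Σℤ n (λ v → x v * δ r y) ≡ +0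
    baseTerm = trans (Σℤ-cong n (λ v → ℤP.*-comm (x v) (δ r y)))
                     (trans (∑-*ˡ (allFin n) (δ r y) x) (trans (cong (δ r y *_) deg0) (ℤP.*-zeroʳ (δ r y))))

  generated-by : ∀ (g : Config G) (r : Fin n) (c : Fin n → ℤ) →
    (∀ v → InIm G (λ y → δ v y - δ r y - c v * g y)) →
    ∀ x → Σℤ n x ≡ +0 → InIm G (λ y → x y - Σℤ n (λ v → x v * c v) * g y)
  generated-by g r c h x deg0 =
    InIm-resp combine (InIm-∑ (allFin n) (λ v y → x v * (δ v y - δ r y - c v * g y)) (λ v → InIm-* (x v) (h v)))
    where
    combine : ∀ y → ∑ (λ v → x v * (δ v y - δ r y - c v * g y)) (allFin n) ≡ x y - Σℤ n (λ v → x v * c v) * g y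
    combine y = trans (∑-cong (allFin n) (λ v → regroup (x v) (δ v y - δ r y) (c v) (g y)))
      (trans (∑-- (allFin n) _ _) (cong₂ _-_ (sym (degree0-decomposition x r deg0 y))
         (trans (∑-*ˡ (allFin n) (g y) _) (ℤP.*-comm (g y) _))))
      where
      regroup : ∀ a d c g → a * (d - c * g) ≡ a * d - g * (a * c)
      regroup = solve-∀

-- Let g = δ_{q₁} - δ_{q₀}.
-- Suppose every δ_v - δ_{q₀} is congruent to a multiple of g modulo Im L, and
-- there is a potential H with  L H = a (δ_{q₀} - δ_{q₁})  and  H(q₀) - H(q₁) = b,
-- where gcd(a, b) = 1.  Then a g ∈ Im L, so g is torsion; every torsion class
-- has degree 0 and hence is a multiple of g; and if m g = L z then pairing with H
-- (L is symmetric) gives  m b = ± a (z q₀ - z q₁), so a ∣ m.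
record CyclicCertificate (G : Graph) (a b : ℕ) : Set where
  field
    q₀ q₁ : Fin (nv G)
    generates : ∀ v → Σ ℤ λ c → InIm G (λ y → δ v y - δ q₀ y - c * (δ q₁ y - δ q₀ y))
    potential : Config G
    potential-eq : ∀ v → + a * (δ q₀ v - δ q₁ v) ≡ edgeLaplacian G potential v
    potential-drop : potential q₀ - potential q₁ ≡ + b
    coprime : Coprime a b
    a-pos : 1 ≤ a

module _ {G : Graph} {a b : ℕ} (cert : CyclicCertificate G a b) where
  open CyclicCertificate cert
  private
    n : ℕ
    n = nv G
    H : Config G
    H = potential

  generator : Config G
  generator v = δ q₁ v - δ q₀ v

  annihilates : InIm G (λ v → + a * generator v)
  annihilates = InIm-resp G (λ v → flip (+ a) (δ q₀ v) (δ q₁ v)) (InIm-* G (- + 1) (H , potential-eq))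
    where
    flip : ∀ a x y → - + 1 * (a * (x - y)) ≡ a * (y - x)
    flip = solve-∀

  torsion-degree0 : ∀ x → IsTorsion G x → Σℤ n x ≡ +0
  torsion-degree0 x (zero , () , _)
  torsion-degree0 x (suc m , _ , mx∈Im) with InImL⇒InIm G mx∈Im
  ... | z , p = ℤP.*-cancelˡ-≡ (+ suc m) (Σℤ n x) +0
    (trans (sym (∑-*ˡ (allFin n) (+ suc m) x)) (trans (Σℤ-cong n p) (trans (degree-image G z) (sym (ℤP.*-zeroʳ (+ suc m))))))

  generates-torsion : ∀ x → IsTorsion G x → Σ ℤ λ c → _≈[_]_ {G} x G (scale G c generator)
  generates-torsion x t =
    Σℤ n (λ v → x v * proj₁ (generates v)) ,
    InIm⇒InImL G (generated-by G generator q₀ (λ v → proj₁ (generates v)) (λ v → proj₂ (generates v)) x (torsion-degree0 x t))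

  pairing : ∀ m z → (∀ v → + m * generator v ≡ edgeLaplacian G z v) → - (+ m * + b) ≡ + a * (z q₀ - z q₁)
  pairing m z p = begin
      - (+ m * + b)
    ≡⟨ cong (λ t → - (+ m * t)) (sym potential-drop) ⟩
      - (+ m * (H q₀ - H q₁))
    ≡⟨ negate (+ m) (H q₀) (H q₁) ⟩
      + m * (H q₁ - H q₀)
    ≡⟨ sym (pairWith H q₁ q₀ (+ m)) ⟩
      Σℤ n (λ v → H v * (+ m * generator v))
    ≡⟨ Σℤ-cong n (λ v → cong (H v *_) (p v)) ⟩
      Σℤ n (λ v → H v * edgeLaplacian G z v)
    ≡⟨ laplacian-symmetric G H z ⟩
      Σℤ n (λ v → z v * edgeLaplacian G H v)
    ≡⟨ Σℤ-cong n (λ v → cong (z v *_) (sym (potential-eq v))) ⟩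
      Σℤ n (λ v → z v * (+ a * (δ q₀ v - δ q₁ v)))
    ≡⟨ pairWith z q₀ q₁ (+ a) ⟩
      + a * (z q₀ - z q₁)
    ∎
    where
    open ≡-Reasoning
    negate : ∀ m x y → - (m * (x - y)) ≡ m * (y - x)
    negate = solve-∀
    pairWith : ∀ (C : Config G) (s t : Fin n) k → Σℤ n (λ v → C v * (k * (δ s v - δ t v))) ≡ k * (C s - C t)
    pairWith C s t k =
      trans (Σℤ-cong n (λ v → regroup (C v) k (δ s v) (δ t v)))
            (trans (∑-*ˡ (allFin n) k _) (cong (k *_) (trans (∑-- (allFin n) _ _) (cong₂ _-_ (Σℤ-δʳ G s C) (Σℤ-δʳ G t C)))))
      where
      regroup : ∀ c k x y → c * (k * (x - y)) ≡ k * (c * x - c * y)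
      regroup = solve-∀

  -- no m with 0 < m < a kills g, since  a ∣ m b  and  gcd(a, b) = 1  force a ∣ m
  order-minimal : ∀ m → 1 ≤ m → m < a → ¬ InImL G (scale G (+ m) generator)
  order-minimal m m≥1 m<a m∈Im with InImL⇒InIm G m∈Im
  ... | z , p = ℕP.<⇒≱ m<a (∣⇒≤ ⦃ ℕ.>-nonZero m≥1 ⦄ (coprime-divisor coprime (divides ℤ.∣ z q₀ - z q₁ ∣ a∣bm)))
    where
    a∣bm : b ℕ.* m ≡ ℤ.∣ z q₀ - z q₁ ∣ ℕ.* a
    a∣bm = begin
        b ℕ.* m
      ≡⟨ ℕP.*-comm b m ⟩
        m ℕ.* b
      ≡⟨ sym (ℤP.abs-* (+ m) (+ b)) ⟩
        ℤ.∣ + m * + b ∣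
      ≡⟨ sym (ℤP.∣-i∣≡∣i∣ (+ m * + b)) ⟩
        ℤ.∣ - (+ m * + b) ∣
      ≡⟨ cong ℤ.∣_∣ (pairing m z p) ⟩
        ℤ.∣ + a * (z q₀ - z q₁) ∣
      ≡⟨ ℤP.abs-* (+ a) (z q₀ - z q₁) ⟩
        a ℕ.* ℤ.∣ z q₀ - z q₁ ∣
      ≡⟨ ℕP.*-comm a _ ⟩
        ℤ.∣ z q₀ - z q₁ ∣ ℕ.* a
      ∎
      where open ≡-Reasoning

  cyclic-of-order : SandpileCyclicOfOrder G a
  cyclic-of-order =
    generator , (a , a-pos , InIm⇒InImL G annihilates) , generates-torsion , a-pos , InIm⇒InImL G annihilates , order-minimal

nth : {A : Set} → List A → A → ℕ → A
nth [] d i = d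
nth (x ∷ l) d zero = x
nth (x ∷ l) d (suc i) = nth l d i

module _ {A : Set} where

  ∑-consecPairs : (l : List A) (d : A) (f : A × A → ℤ) →
    ∑ f (consecPairs l) ≡ Σr (length l ∸ 1) (λ i → f (nth l d i , nth l d (suc i)))
  ∑-consecPairs [] d f = refl
  ∑-consecPairs (a ∷ []) d f = refl
  ∑-consecPairs (a ∷ b ∷ r) d f = cong (_+_ (f (a , b))) (∑-consecPairs (b ∷ r) d f)

  length-consecPairs : (l : List A) → length (consecPairs l) ≡ length l ∸ 1
  length-consecPairs [] = refl
  length-consecPairs (a ∷ []) = refl
  length-consecPairs (a ∷ b ∷ r) = cong suc (length-consecPairs (b ∷ r))

  lookup-consecPairs : (l : List A) (d : A) (i : Fin (length (consecPairs l))) →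
    lookup (consecPairs l) i ≡ (nth l d (toℕ i) , nth l d (suc (toℕ i)))
  lookup-consecPairs (a ∷ b ∷ r) d F.zero = refl
  lookup-consecPairs (a ∷ b ∷ r) d (F.suc i) = lookup-consecPairs (b ∷ r) d i

  adjPair-sound : (l : List A) (d : A) (j : ℕ) (x y : A) → adjPair l j ≡ just (x , y) →
    (x ≡ nth l d j) × (y ≡ nth l d (suc j)) × (suc j < length l)
  adjPair-sound (a ∷ b ∷ r) d zero x y refl = refl , refl , s≤s (s≤s z≤n)
  adjPair-sound (a ∷ b ∷ r) d (suc j) x y eq with adjPair-sound (b ∷ r) d j x y eq
  ... | x≡ , y≡ , j< = x≡ , y≡ , s≤s j<

  adjPair-complete : (l : List A) (d : A) (j : ℕ) → suc j < length l →
    adjPair l j ≡ just (nth l d j , nth l d (suc j))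
  adjPair-complete (a ∷ b ∷ r) d zero p = refl
  adjPair-complete (a ∷ b ∷ r) d (suc j) (s≤s p) = adjPair-complete (b ∷ r) d j p
  adjPair-complete (a ∷ []) d j (s≤s ())

  nth-middle : ∀ m (h : Fin m → A) (y d : A) i → i < m →
    Σ (Fin m) λ t → (toℕ t ≡ i) × (nth (tabulate h ++ [ y ]) d i ≡ h t)
  nth-middle (suc m) h y d zero p = F.zero , refl , refl
  nth-middle (suc m) h y d (suc i) (s≤s p) with nth-middle m (λ t → h (F.suc t)) y d i p
  ... | t , t≡i , eq = F.suc t , cong suc t≡i , eq

  nth-last : ∀ m (h : Fin m → A) (y d : A) → nth (tabulate h ++ [ y ]) d m ≡ y
  nth-last zero h y d = refl
  nth-last (suc m) h y d = nth-last m (λ t → h (F.suc t)) y d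

data VertexView (n m : ℕ) : Fin (n ℕ.+ m) → Set where
  old : (x : Fin n) → VertexView n m (x ↑ˡ m)
  new : (t : Fin m) → VertexView n m (n ↑ʳ t)

vertexView : ∀ n m v → VertexView n m v
vertexView zero m v = new v
vertexView (suc n) m F.zero = old F.zero
vertexView (suc n) m (F.suc v) with vertexView n m v
... | old x = old (F.suc x)
... | new t = new t

join : ∀ n m → (Fin n → ℤ) → (Fin m → ℤ) → Fin (n ℕ.+ m) → ℤ
join n m a b v = [ a , b ]′ (splitAt n v)

join-old : ∀ n m a b (x : Fin n) → join n m a b (x ↑ˡ m) ≡ a x
join-old n m a b x = cong [ a , b ]′ (FP.splitAt-↑ˡ n x m)

join-new : ∀ n m a b (t : Fin m) → join n m a b (n ↑ʳ t) ≡ b t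
join-new n m a b t = cong [ a , b ]′ (FP.splitAt-↑ʳ n m t)

zeroExtend : ∀ n m → (Fin n → ℤ) → Fin (n ℕ.+ m) → ℤ
zeroExtend n m f = join n m f (λ _ → +0)

zeroExtend-cong : ∀ n m {f g : Fin n → ℤ} → (∀ y → f y ≡ g y) → ∀ v → zeroExtend n m f v ≡ zeroExtend n m g v
zeroExtend-cong n m eq v with vertexView n m v
... | old x = trans (join-old n m _ _ x) (trans (eq x) (sym (join-old n m _ _ x)))
... | new t = trans (join-new n m _ _ t) (sym (join-new n m _ _ t))

zeroExtend-pointwise : ∀ n m (F : ℤ → ℤ → ℤ → ℤ) → F +0 +0 +0 ≡ +0 → (f₁ f₂ f₃ : Fin n → ℤ) → ∀ v →
  zeroExtend n m (λ y → F (f₁ y) (f₂ y) (f₃ y)) v ≡ F (zeroExtend n m f₁ v) (zeroExtend n m f₂ v) (zeroExtend n m f₃ v)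
zeroExtend-pointwise n m F F0 f₁ f₂ f₃ v with vertexView n m v
... | old x = trans (join-old n m _ _ x) (sym (cong₃ (join-old n m f₁ _ x) (join-old n m f₂ _ x) (join-old n m f₃ _ x)))
  where
  cong₃ : ∀ {a b c a' b' c'} → a ≡ a' → b ≡ b' → c ≡ c' → F a b c ≡ F a' b' c'
  cong₃ refl refl refl = refl
... | new t = trans (join-new n m _ _ t) (trans (sym F0) (sym (cong₃ (join-new n m f₁ _ t) (join-new n m f₂ _ t) (join-new n m f₃ _ t))))
  where
  cong₃ : ∀ {a b c a' b' c'} → a ≡ a' → b ≡ b' → c ≡ c' → F a b c ≡ F a' b' c'
  cong₃ refl refl refl = refl

eqᵇ-old-old : ∀ {n} m (x y : Fin n) → eqᵇ (x ↑ˡ m) (y ↑ˡ m) ≡ eqᵇ x y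
eqᵇ-old-old m = eqᵇ-inj (_↑ˡ m) (FP.↑ˡ-injective m _ _)

eqᵇ-old-new : ∀ {n} m (x : Fin n) (t : Fin m) → eqᵇ (x ↑ˡ m) (n ↑ʳ t) ≡ false
eqᵇ-old-new {n} m x t = eqᵇ-false old≢new
  where
  old≢new : x ↑ˡ m ≢ n ↑ʳ t
  old≢new eq with trans (sym (FP.splitAt-↑ˡ n x m)) (trans (cong (splitAt n) eq) (FP.splitAt-↑ʳ n m t))
  ... | ()

zeroExtend-δ : ∀ n m (x : Fin n) v → zeroExtend n m (δ x) v ≡ δ (x ↑ˡ m) v
zeroExtend-δ n m x v with vertexView n m v
... | old y = trans (join-old n m _ _ y) (sym (cong ind (eqᵇ-old-old m x y)))
... | new t = trans (join-new n m _ _ t) (sym (cong ind (eqᵇ-old-new m x t)))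

-- The graph of PC_i:  G together with a path u = q₀, q₁, …, q_{m+1} = w  through
-- m new vertices;  addPath P u w k  builds exactly this graph with m = k ∸ 2.

newPath : (n m : ℕ) → Fin n → Fin n → List (Fin (n ℕ.+ m))
newPath n m u w = (u ↑ˡ m) ∷ (map (n ↑ʳ_) (allFin m) ++ [ w ↑ˡ m ])

liftEdge : ∀ {n} m → Fin n × Fin n → Fin (n ℕ.+ m) × Fin (n ℕ.+ m)
liftEdge m e = proj₁ e ↑ˡ m , proj₂ e ↑ˡ m

extendedGraph : (G : Graph) → Fin (nv G) → Fin (nv G) → ℕ → Graph
extendedGraph G u w m = mkGraph (nv G ℕ.+ m) (map (liftEdge m) (edges G) ++ consecPairs (newPath (nv G) m u w))

prefixSum : ℤ → (ℕ → ℤ) → ℕ → ℤ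
prefixSum z₀ s zero = z₀
prefixSum z₀ s (suc i) = prefixSum z₀ s i + s i

prefixSum≡ : ∀ M z₀ s → prefixSum z₀ s M ≡ z₀ + Σr M s
prefixSum≡ zero z₀ s = sym (ℤP.+-identityʳ z₀)
prefixSum≡ (suc M) z₀ s = trans (shift M z₀ s) (trans (prefixSum≡ M (z₀ + s 0) (λ i → s (suc i))) (ℤP.+-assoc z₀ (s 0) _))
  where
  shift : ∀ M z₀ s → prefixSum z₀ s (suc M) ≡ prefixSum (z₀ + s 0) (λ i → s (suc i)) M
  shift zero z₀ s = refl
  shift (suc M) z₀ s = cong (_+ s (suc M)) (shift M z₀ s)

module PathExtension (G : Graph) (u w : Fin (nv G)) (m : ℕ) where
  n : ℕ
  n = nv G

  G' : Graph
  G' = extendedGraph G u w m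

  L : List (Fin (n ℕ.+ m))
  L = newPath n m u w

  q : ℕ → Fin (n ℕ.+ m)
  q i = nth L (u ↑ˡ m) i

  pathLength : length L ∸ 1 ≡ suc m
  pathLength = trans (LP.length-++ (map (n ↑ʳ_) (allFin m)))
    (trans (cong (ℕ._+ 1) (trans (LP.length-map (n ↑ʳ_) (allFin m)) (LP.length-tabulate (λ x → x)))) (ℕP.+-comm m 1))

  q-last : q (suc m) ≡ w ↑ˡ m
  q-last = trans (cong (λ l → nth (l ++ [ w ↑ˡ m ]) (u ↑ˡ m) m) (LP.map-tabulate (λ x → x) (n ↑ʳ_)))
                 (nth-last m (n ↑ʳ_) (w ↑ˡ m) (u ↑ˡ m))

  q-middle : ∀ i → i < m → Σ (Fin m) λ t → (toℕ t ≡ i) × (q (suc i) ≡ n ↑ʳ t)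
  q-middle i p with nth-middle m (n ↑ʳ_) (w ↑ˡ m) (u ↑ˡ m) i p
  ... | t , t≡i , eq = t , t≡i , trans (cong (λ l → nth (l ++ [ w ↑ˡ m ]) (u ↑ˡ m) i) (LP.map-tabulate (λ x → x) (n ↑ʳ_))) eq

  q-new : ∀ (t : Fin m) → q (suc (toℕ t)) ≡ n ↑ʳ t
  q-new t with q-middle (toℕ t) (FP.toℕ<n t)
  ... | t' , t'≡t , eq = trans eq (cong (n ↑ʳ_) (FP.toℕ-injective t'≡t))

  adjPair-path : ∀ j → j ≤ m → adjPair L j ≡ just (q j , q (suc j))
  adjPair-path j p = adjPair-complete L (u ↑ˡ m) j (subst (suc (suc j) ≤_) (sym (cong suc pathLength)) (s≤s (s≤s p)))

  adjPair-path-bound : ∀ {j} → suc j < length L → j ≤ m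
  adjPair-path-bound {j} p = ℕP.≤-pred (ℕP.≤-pred (subst (suc (suc j) ≤_) (cong suc pathLength) p))

  D : Fin (n ℕ.+ m) → ℕ → ℤ
  D v i = δ (q i) v - δ (q (suc i)) v

  private
    term : (Fin (n ℕ.+ m) → ℤ) → Fin (n ℕ.+ m) → Fin (n ℕ.+ m) × Fin (n ℕ.+ m) → ℤ
    term z v e = (z (proj₁ e) - z (proj₂ e)) * (δ (proj₁ e) v - δ (proj₂ e) v)

  edgeLaplacian-split : ∀ z v → edgeLaplacian G' z v ≡
    ∑ (λ e → term z v (liftEdge m e)) (edges G) + Σr (suc m) (λ i → (z (q i) - z (q (suc i))) * D v i)
  edgeLaplacian-split z v = trans (∑-++ (map (liftEdge m) (edges G)) (consecPairs L) (term z v))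
    (cong₂ _+_ (∑-map (edges G) (liftEdge m) (term z v))
               (trans (∑-consecPairs L (u ↑ˡ m) (term z v)) (cong (λ M → Σr M (λ i → (z (q i) - z (q (suc i))) * D v i)) pathLength)))

  oldEdges : ∀ zo zn v → ∑ (λ e → term (join n m zo zn) v (liftEdge m e)) (edges G) ≡ zeroExtend n m (edgeLaplacian G zo) v
  oldEdges zo zn v with vertexView n m v
  ... | old x = trans (∑-cong (edges G) (λ e →
          cong₂ _*_ (cong₂ _-_ (join-old n m zo zn (proj₁ e)) (join-old n m zo zn (proj₂ e)))
                    (cong₂ _-_ (cong ind (eqᵇ-old-old m (proj₁ e) x)) (cong ind (eqᵇ-old-old m (proj₂ e) x)))))
          (sym (join-old n m _ _ x))
  ... | new t = trans (∑-cong (edges G) (λ e →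
          trans (cong (_*_ (join n m zo zn (proj₁ e ↑ˡ m) - join n m zo zn (proj₂ e ↑ˡ m))) (cong₂ _-_ (cong ind (eqᵇ-old-new m (proj₁ e) t)) (cong ind (eqᵇ-old-new m (proj₂ e) t))))
                (ℤP.*-zeroʳ (join n m zo zn (proj₁ e ↑ˡ m) - join n m zo zn (proj₂ e ↑ˡ m)))))
          (trans (∑-0 (edges G)) (sym (join-new n m _ _ t)))

  module PathPotential (zo : Fin n → ℤ) (z₀ : ℤ) (s : ℕ → ℤ) (zo-u : zo u ≡ z₀) (zo-w : zo w ≡ prefixSum z₀ s (suc m)) where
    z : Fin (n ℕ.+ m) → ℤ
    z = join n m zo (λ t → prefixSum z₀ s (suc (toℕ t)))

    z-path : ∀ i → i ≤ suc m → z (q i) ≡ prefixSum z₀ s i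
    z-path zero _ = trans (join-old n m _ _ u) zo-u
    z-path (suc i) (s≤s p) with ℕP.m≤n⇒m<n∨m≡n p
    ... | inj₁ i<m with q-middle i i<m
    ...   | t , t≡i , eq = trans (cong z eq) (trans (join-new n m _ _ t) (cong (λ r → prefixSum z₀ s (suc r)) t≡i))
    z-path (suc i) (s≤s p) | inj₂ refl = trans (cong z q-last) (trans (join-old n m _ _ w) zo-w)

    laplacian-z : ∀ v → edgeLaplacian G' z v ≡ zeroExtend n m (edgeLaplacian G zo) v - Σr (suc m) (λ i → s i * D v i)
    laplacian-z v = trans (edgeLaplacian-split z v) (cong₂ _+_ (oldEdges zo _ v) pathEdges)
      where
      drop : ∀ a b → a - (a + b) ≡ - + 1 * b
      drop = solve-∀
      pathEdges : Σr (suc m) (λ i → (z (q i) - z (q (suc i))) * D v i) ≡ - Σr (suc m) (λ i → s i * D v i)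
      pathEdges = trans (Σr-cong (suc m) (λ i p → cong (_* D v i)
                          (trans (cong₂ _-_ (z-path i (ℕP.<⇒≤ p)) (z-path (suc i) p)) (drop (prefixSum z₀ s i) (s i)))))
                   (trans (Σr-cong (suc m) (λ i _ → ℤP.*-assoc (- + 1) (s i) (D v i)))
                   (trans (Σr-* (suc m) (- + 1) (λ i → s i * D v i)) (ℤP.-1*i≡-i _)))

record SandpileInvariant (G : Graph) (P : List (Fin (nv G))) (a b : ℕ) : Set where
  field
    q₀ q₁ : Fin (nv G)
    first : adjPair P 0 ≡ just (q₀ , q₁)
    edgeStep : ∀ j x y → adjPair P j ≡ just (x , y) → InIm G (λ v → δ y v - δ x v - (δ q₁ v - δ q₀ v))
    generates : ∀ v → Σ ℤ λ c → InIm G (λ y → δ v y - δ q₀ y - c * (δ q₁ y - δ q₀ y))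
    potential : ∀ j x y → adjPair P j ≡ just (x , y) →
      Σ (Config G) λ H → (∀ v → + a * (δ x v - δ y v) ≡ edgeLaplacian G H v) × (H x - H y ≡ + b)
    coprime : Coprime a b
    a-pos : 1 ≤ a

certificate : ∀ {G P a b} → SandpileInvariant G P a b → CyclicCertificate G a b
certificate {G} {P} {a} {b} I = record
  { q₀ = q₀ ; q₁ = q₁ ; generates = generates
  ; potential = proj₁ firstPotential ; potential-eq = proj₁ (proj₂ firstPotential)
  ; potential-drop = proj₂ (proj₂ firstPotential) ; coprime = coprime ; a-pos = a-pos }
  where
  open SandpileInvariant I
  firstPotential : Σ (Config G) λ H → (∀ v → + a * (δ q₀ v - δ q₁ v) ≡ edgeLaplacian G H v) × (H q₀ - H q₁ ≡ + b)
  firstPotential = potential 0 q₀ q₁ first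

sandpile-pc0 : SandpileInvariant (graph pc0) (path pc0) 1 1
sandpile-pc0 = record
  { q₀ = v₀ ; q₁ = v₁ ; first = refl
  ; edgeStep = edgeStep ; generates = generates ; potential = potential
  ; coprime = λ d∣ → ∣1⇒≡1 (proj₁ d∣) ; a-pos = s≤s z≤n }
  where
  G₀ : Graph
  G₀ = graph pc0
  v₀ v₁ : Fin 2
  v₀ = F.zero
  v₁ = F.suc F.zero
  vanishing : ∀ (f : Fin 2 → ℤ) → (∀ v → f v ≡ +0) → InIm G₀ f
  vanishing f h = InIm-resp G₀ (λ v → sym (h v)) (InIm-0 G₀)
  edgeStep : ∀ j x y → adjPair (path pc0) j ≡ just (x , y) → InIm G₀ (λ v → δ y v - δ x v - (δ v₁ v - δ v₀ v))
  edgeStep zero x y refl = vanishing _ λ { F.zero → refl ; (F.suc F.zero) → refl }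
  edgeStep (suc zero) x y ()
  edgeStep (suc (suc j)) x y ()
  generates : ∀ v → Σ ℤ λ c → InIm G₀ (λ y → δ v y - δ v₀ y - c * (δ v₁ y - δ v₀ y))
  generates F.zero = +0 , vanishing _ λ { F.zero → refl ; (F.suc F.zero) → refl }
  generates (F.suc F.zero) = + 1 , vanishing _ λ { F.zero → refl ; (F.suc F.zero) → refl }
  potential : ∀ j x y → adjPair (path pc0) j ≡ just (x , y) →
    Σ (Config G₀) λ H → (∀ v → + 1 * (δ x v - δ y v) ≡ edgeLaplacian G₀ H v) × (H x - H y ≡ + 1)
  potential zero x y refl = δ v₀ , (λ { F.zero → refl ; (F.suc F.zero) → refl }) , refl
  potential (suc zero) x y ()
  potential (suc (suc j)) x y ()

module SandpileStep (G : Graph) (P : List (Fin (nv G))) (a b : ℕ) (I : SandpileInvariant G P a b)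
                    (J : ℕ) (u w : Fin (nv G)) (uw∈P : adjPair P J ≡ just (u , w)) (m : ℕ) where
  open PathExtension G u w m
  open SandpileInvariant I

  a' b' : ℕ
  a' = suc m ℕ.* a ℕ.+ b
  b' = m ℕ.* a ℕ.+ b

  g : Config G
  g v = δ q₁ v - δ q₀ v

  g' : Config G'
  g' v = δ (q 1) v - δ (q 0) v

  -- each new path edge differs from the first one by an element of Im L':
  -- the potential vanishing on G and stepping +1 on edge 0, -1 on edge j
  pathEdgeStep : ∀ j → j ≤ m → InIm G' (λ v → δ (q (suc j)) v - δ (q j) v - g' v)
  pathEdgeStep j j≤m = InIm-resp G' equation (InIm-* G' (- + 1) (Z.z , λ v → refl))
    where
    s : ℕ → ℤ
    s i = ind (i ≡ᵇ 0) - ind (i ≡ᵇ j)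
    Σr-ind : ∀ k → k ≤ m → Σr (suc m) (λ i → ind (i ≡ᵇ k)) ≡ + 1
    Σr-ind k p = trans (Σr-cong (suc m) (λ i _ → sym (ℤP.*-identityʳ (ind (i ≡ᵇ k))))) (Σr-pick (suc m) k (λ _ → + 1) (s≤s p))
    closes : +0 ≡ prefixSum +0 s (suc m)
    closes = sym (trans (prefixSum≡ (suc m) +0 s) (trans (ℤP.+-identityˡ (Σr (suc m) s))
               (trans (Σr-- (suc m) (λ i → ind (i ≡ᵇ 0)) (λ i → ind (i ≡ᵇ j))) (cong₂ _-_ (Σr-ind 0 z≤n) (Σr-ind j j≤m)))))
    module Z = PathPotential (λ _ → +0) +0 s refl closes
    ΣsD : ∀ v → Σr (suc m) (λ i → s i * D v i) ≡ D v 0 - D v j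
    ΣsD v = trans (Σr-cong (suc m) (λ i _ → distrib (ind (i ≡ᵇ 0)) (ind (i ≡ᵇ j)) (D v i)))
      (trans (Σr-- (suc m) (λ i → ind (i ≡ᵇ 0) * D v i) (λ i → ind (i ≡ᵇ j) * D v i))
             (cong₂ _-_ (Σr-pick (suc m) 0 (D v) (s≤s z≤n)) (Σr-pick (suc m) j (D v) (s≤s j≤m))))
      where
      distrib : ∀ a b c → (a - b) * c ≡ a * c - b * c
      distrib = solve-∀
    zero-extension : ∀ v → zeroExtend n m (edgeLaplacian G (λ _ → +0)) v ≡ +0
    zero-extension v = trans (zeroExtend-cong n m (edgeLaplacian-0 G) v)
                             (zeroExtend-pointwise n m (λ _ _ _ → +0) refl (λ _ → +0) (λ _ → +0) (λ _ → +0) v)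
    equation : ∀ v → - + 1 * edgeLaplacian G' Z.z v ≡ δ (q (suc j)) v - δ (q j) v - g' v
    equation v = trans (cong (- + 1 *_) (trans (Z.laplacian-z v) (cong₂ _-_ (zero-extension v) (ΣsD v))))
                       (rearrange (δ (q 0) v) (δ (q 1) v) (δ (q j) v) (δ (q (suc j)) v))
      where
      rearrange : ∀ a₀ a₁ aⱼ aⱼ₊₁ → - + 1 * (+0 - ((a₀ - a₁) - (aⱼ - aⱼ₊₁))) ≡ aⱼ₊₁ - aⱼ - (a₁ - a₀)
      rearrange = solve-∀

  edgeStep' : ∀ j x y → adjPair L j ≡ just (x , y) → InIm G' (λ v → δ y v - δ x v - g' v)
  edgeStep' j x y xy∈L with adjPair-sound L (u ↑ˡ m) j x y xy∈L
  ... | refl , refl , j< = pathEdgeStep j (adjPair-path-bound j<)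

  alongPath : ∀ i → i ≤ suc m → InIm G' (λ v → δ (q i) v - δ (q 0) v - + i * g' v)
  alongPath zero _ = InIm-resp G' (λ v → sym (cancel (δ (q 0) v) (g' v))) (InIm-0 G')
    where
    cancel : ∀ x g → x - x - + 0 * g ≡ +0
    cancel = solve-∀
  alongPath (suc i) (s≤s i≤m) =
    InIm-resp G' (λ v → add (δ (q i) v) (δ (q 0) v) (δ (q (suc i)) v) (g' v) (+ i))
                 (InIm-+ G' (alongPath i (ℕP.m≤n⇒m≤1+n i≤m)) (pathEdgeStep i i≤m))
    where
    add : ∀ xᵢ x₀ xᵢ₊₁ g k → (xᵢ - x₀ - k * g) + (xᵢ₊₁ - xᵢ - g) ≡ xᵢ₊₁ - x₀ - (+ 1 + k) * g
    add = solve-∀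

  -- lifting an old Laplacian:  L z extended by 0 is  -(z w - z u) g'  modulo Im L'
  -- (extend z linearly along the path, putting the whole increase on the last edge)
  liftLaplacian : ∀ (z : Config G) → InIm G' (λ v → zeroExtend n m (edgeLaplacian G z) v + (z w - z u) * g' v)
  liftLaplacian z = InIm-resp G' equation (InIm-+ G' (Z.z , λ v → refl) (InIm-* G' (- c) (pathEdgeStep m ℕP.≤-refl)))
    where
    c : ℤ
    c = z w - z u
    s : ℕ → ℤ
    s i = ind (i ≡ᵇ m) * c
    closes : z w ≡ prefixSum (z u) s (suc m)
    closes = sym (trans (prefixSum≡ (suc m) (z u) s)
      (trans (cong (_+_ (z u)) (Σr-pick (suc m) m (λ _ → c) (s≤s ℕP.≤-refl))) (cancel (z u) (z w))))
      where
      cancel : ∀ x y → x + (y - x) ≡ y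
      cancel = solve-∀
    module Z = PathPotential z (z u) s refl closes
    ΣsD : ∀ v → Σr (suc m) (λ i → s i * D v i) ≡ c * D v m
    ΣsD v = trans (Σr-cong (suc m) (λ i _ → ℤP.*-assoc (ind (i ≡ᵇ m)) c (D v i))) (Σr-pick (suc m) m (λ i → c * D v i) (s≤s ℕP.≤-refl))
    equation : ∀ v → edgeLaplacian G' Z.z v + - c * (δ (q (suc m)) v - δ (q m) v - g' v) ≡ zeroExtend n m (edgeLaplacian G z) v + c * g' v
    equation v = trans (cong (_+ - c * (δ (q (suc m)) v - δ (q m) v - g' v))
                             (trans (Z.laplacian-z v) (cong (_-_ (zeroExtend n m (edgeLaplacian G z) v)) (ΣsD v))))
                       (rearrange (zeroExtend n m (edgeLaplacian G z) v) c (δ (q m) v) (δ (q (suc m)) v) (g' v))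
      where
      rearrange : ∀ e c x y g → e - c * (x - y) + - c * (y - x - g) ≡ e + c * g
      rearrange = solve-∀

  liftImage : ∀ f → InIm G f → Σ ℤ λ k → InIm G' (λ v → zeroExtend n m f v + k * g' v)
  liftImage f (z , f≡Lz) =
    z w - z u , InIm-resp G' (λ v → cong (_+ (z w - z u) * g' v) (zeroExtend-cong n m (λ y → sym (f≡Lz y)) v)) (liftLaplacian z)

  difference : ∀ x y → Σ ℤ λ c → InIm G (λ v → δ x v - δ y v - c * g v)
  difference x y with generates x | generates y
  ... | cx , rx | cy , ry =
    cx - cy , InIm-resp G (λ v → subtract (δ x v) (δ y v) (δ q₀ v) cx cy (g v)) (InIm-+ G rx (InIm-* G (- + 1) ry))
    where
    subtract : ∀ X Y Q cx cy g → X - Q - cx * g + - + 1 * (Y - Q - cy * g) ≡ X - Y - (cx - cy) * g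
    subtract = solve-∀

  -- an old vertex x:  in G,  δ_x - δ_u ≡ c (δ_w - δ_u);  lifting to G' costs a
  -- multiple of g', and  δ_w - δ_u = δ_{q(m+1)} - δ_{q 0} ≡ (m+1) g'
  oldVertex : ∀ x → Σ ℤ λ C → InIm G' (λ v → δ (x ↑ˡ m) v - δ (q 0) v - C * g' v)
  oldVertex x with difference x u
  ... | c , rx = c * + suc m - k ,
      InIm-resp G' equation (InIm-+ G' lifted (InIm-* G' c (alongPath (suc m) ℕP.≤-refl)))
    where
    f : Config G
    f v = δ x v - δ u v - c * (δ w v - δ u v)
    f∈Im : InIm G f
    f∈Im = InIm-resp G (λ v → regroup (δ x v) (δ u v) (δ w v) (g v) c) (InIm-+ G rx (InIm-* G (- c) (edgeStep J u w uw∈P)))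
      where
      regroup : ∀ X U W g c → X - U - c * g + - c * (W - U - g) ≡ X - U - c * (W - U)
      regroup = solve-∀
    k : ℤ
    k = proj₁ (liftImage f f∈Im)
    lifted : InIm G' (λ v → zeroExtend n m f v + k * g' v)
    lifted = proj₂ (liftImage f f∈Im)
    extend-f : ∀ v → zeroExtend n m f v ≡ δ (x ↑ˡ m) v - δ (u ↑ˡ m) v - c * (δ (w ↑ˡ m) v - δ (u ↑ˡ m) v)
    extend-f v = trans (zeroExtend-pointwise n m (λ X U W → X - U - c * (W - U)) (vanish c) (δ x) (δ u) (δ w) v)
                       (cong₃ (zeroExtend-δ n m x v) (zeroExtend-δ n m u v) (zeroExtend-δ n m w v))
      where
      vanish : ∀ c → +0 - +0 - c * (+0 - +0) ≡ +0
      vanish = solve-∀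
      cong₃ : ∀ {X U W X' U' W'} → X ≡ X' → U ≡ U' → W ≡ W' → X - U - c * (W - U) ≡ X' - U' - c * (W' - U')
      cong₃ refl refl refl = refl
    equation : ∀ v → zeroExtend n m f v + k * g' v + c * (δ (q (suc m)) v - δ (q 0) v - + suc m * g' v)
                     ≡ δ (x ↑ˡ m) v - δ (q 0) v - (c * + suc m - k) * g' v
    equation v rewrite extend-f v | q-last = regroup (δ (x ↑ˡ m) v) (δ (u ↑ˡ m) v) (δ (w ↑ˡ m) v) (g' v) c k (+ suc m)
      where
      regroup : ∀ X U W g c k M → X - U - c * (W - U) + k * g + c * (W - U - M * g) ≡ X - U - (c * M - k) * g
      regroup = solve-∀

  generates' : ∀ v → Σ ℤ λ C → InIm G' (λ y → δ v y - δ (q 0) y - C * g' y)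
  generates' v with vertexView n m v
  ... | old x = oldVertex x
  ... | new t = + suc (toℕ t) ,
      InIm-resp G' (λ y → cong (λ r → δ r y - δ (q 0) y - + suc (toℕ t) * g' y) (q-new t))
                   (alongPath (suc (toℕ t)) (s≤s (ℕP.<⇒≤ (FP.toℕ<n t))))

  a'≡ : + a' ≡ + suc m * + a + + b
  a'≡ = trans (ℤP.pos-+ (suc m ℕ.* a) b) (cong (_+ + b) (ℤP.pos-* (suc m) a))

  a'≡a+b' : + a' ≡ + a + + b'
  a'≡a+b' = trans (cong +_ (ℕP.+-assoc a (m ℕ.* a) b)) (ℤP.pos-+ a b')

  -- The potential of the j-th new edge extends the potential H of the edge (u, w)
  -- by increments  a - [i = j] a'  along the path; these add up to
  -- (m+1) a - a' = -b = H w - H u, and the Laplacian picks out a' D_j.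
  module EdgePotential (j : ℕ) (j≤m : j ≤ m) where
    H : Config G
    H = proj₁ (potential J u w uw∈P)
    LH : ∀ v → + a * (δ u v - δ w v) ≡ edgeLaplacian G H v
    LH = proj₁ (proj₂ (potential J u w uw∈P))
    H-drop : H u - H w ≡ + b
    H-drop = proj₂ (proj₂ (potential J u w uw∈P))
    s : ℕ → ℤ
    s i = + a - ind (i ≡ᵇ j) * + a'
    Σs : Σr (suc m) s ≡ + suc m * + a - + a'
    Σs = trans (Σr-- (suc m) (λ _ → + a) (λ i → ind (i ≡ᵇ j) * + a'))
               (cong₂ _-_ (Σr-const (suc m) (+ a)) (Σr-pick (suc m) j (λ _ → + a') (s≤s j≤m)))
    closes : H w ≡ prefixSum (H u) s (suc m)
    closes = sym (trans (prefixSum≡ (suc m) (H u) s)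
      (trans (cong (_+_ (H u)) (trans Σs (cong (_-_ (+ suc m * + a)) a'≡))) (close (H u) (H w) (+ suc m * + a) (+ b) H-drop)))
      where
      close : ∀ hu hw X b → hu - hw ≡ b → hu + (X - (X + b)) ≡ hw
      close hu hw X b refl = cancel hu hw X
        where
        cancel : ∀ hu hw X → hu + (X - (X + (hu - hw))) ≡ hw
        cancel = solve-∀
    module Z = PathPotential H (H u) s refl closes
    extend-LH : ∀ v → zeroExtend n m (edgeLaplacian G H) v ≡ + a * (δ (u ↑ˡ m) v - δ (w ↑ˡ m) v)
    extend-LH v = trans (zeroExtend-cong n m (λ y → sym (LH y)) v)
      (trans (zeroExtend-pointwise n m (λ X W _ → + a * (X - W)) (ℤP.*-zeroʳ (+ a)) (δ u) (δ w) (δ u) v)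
             (cong₂ (λ X W → + a * (X - W)) (zeroExtend-δ n m u v) (zeroExtend-δ n m w v)))
    ΣsD : ∀ v → Σr (suc m) (λ i → s i * D v i) ≡ + a * (δ (q 0) v - δ (q (suc m)) v) - + a' * D v j
    ΣsD v = trans (Σr-cong (suc m) (λ i _ → distrib (+ a) (ind (i ≡ᵇ j)) (+ a') (D v i)))
      (trans (Σr-- (suc m) (λ i → + a * D v i) (λ i → ind (i ≡ᵇ j) * (+ a' * D v i)))
        (cong₂ _-_ (trans (Σr-* (suc m) (+ a) (D v)) (cong (+ a *_) (Σr-telescope (suc m) (λ i → δ (q i) v))))
                   (Σr-pick (suc m) j (λ i → + a' * D v i) (s≤s j≤m))))
      where
      distrib : ∀ A I A' d → (A - I * A') * d ≡ A * d - I * (A' * d)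
      distrib = solve-∀
    equation : ∀ v → + a' * D v j ≡ edgeLaplacian G' Z.z v
    equation v rewrite Z.laplacian-z v | extend-LH v | ΣsD v | q-last =
      cancel (+ a) (+ a') (δ (u ↑ˡ m) v) (δ (w ↑ˡ m) v) (D v j)
      where
      cancel : ∀ A A' U W d → A' * d ≡ A * (U - W) - (A * (U - W) - A' * d)
      cancel = solve-∀
    ≡ᵇ-refl : ∀ i → (i ≡ᵇ i) ≡ true
    ≡ᵇ-refl zero = refl
    ≡ᵇ-refl (suc i) = ≡ᵇ-refl i
    drop : Z.z (q j) - Z.z (q (suc j)) ≡ + b'
    drop rewrite Z.z-path j (ℕP.m≤n⇒m≤1+n j≤m) | Z.z-path (suc j) (s≤s j≤m) | ≡ᵇ-refl j =
      trans (edgeDrop (prefixSum (H u) s j) (+ a) (+ a')) (trans (cong (_- + a) a'≡a+b') (cancel (+ a) (+ b')))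
      where
      edgeDrop : ∀ Z A A' → Z - (Z + (A - + 1 * A')) ≡ A' - A
      edgeDrop = solve-∀
      cancel : ∀ A B → A + B - A ≡ B
      cancel = solve-∀


  pathPotential : ∀ j → j ≤ m →
    Σ (Config G') λ H' → (∀ v → + a' * D v j ≡ edgeLaplacian G' H' v) × (H' (q j) - H' (q (suc j)) ≡ + b')
  pathPotential j j≤m = Z.z , equation , drop
    where open EdgePotential j j≤m

  potential' : ∀ j x y → adjPair L j ≡ just (x , y) →
    Σ (Config G') λ H' → (∀ v → + a' * (δ x v - δ y v) ≡ edgeLaplacian G' H' v) × (H' x - H' y ≡ + b')
  potential' j x y xy∈L with adjPair-sound L (u ↑ˡ m) j x y xy∈L
  ... | refl , refl , j< = pathPotential j (adjPair-path-bound j<)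

  -- gcd(a', b') = gcd(a + b', b') = gcd(a, m a + b) = gcd(a, b) = 1
  coprime' : Coprime a' b'
  coprime' {d} (d∣a' , d∣b') = coprime (d∣a , d∣b)
    where
    a'≡b'+a : a' ≡ b' ℕ.+ a
    a'≡b'+a = rearrange m a b
      where
      rearrange : ∀ m a b → suc m ℕ.* a ℕ.+ b ≡ m ℕ.* a ℕ.+ b ℕ.+ a
      rearrange = ℕSolver.solve-∀
    d∣a : d ∣ a
    d∣a = ∣m+n∣m⇒∣n (subst (d ∣_) a'≡b'+a d∣a') d∣b'
    d∣b : d ∣ b
    d∣b = ∣m+n∣m⇒∣n d∣b' (∣n⇒∣m*n m d∣a)

  a'-pos : 1 ≤ a'
  a'-pos = ℕP.≤-trans a-pos (ℕP.≤-trans (ℕP.m≤m+n a (m ℕ.* a)) (ℕP.m≤m+n (a ℕ.+ m ℕ.* a) b))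

  invariant' : SandpileInvariant G' L a' b'
  invariant' = record
    { q₀ = q 0 ; q₁ = q 1 ; first = adjPair-path 0 z≤n
    ; edgeStep = edgeStep' ; generates = generates' ; potential = potential'
    ; coprime = coprime' ; a-pos = a'-pos }

-- The matching polynomial of the path satisfies the continuant recursion
--   M(k₁ k₂ r) = k₁ M(k₂ r) - M(r),
-- obtained by splitting the matchings of P_n according to whether they use the
-- first edge {1, 2}: if not, vertex 1 is uncovered (factor k₁); if so, vertices
-- 1, 2 are covered, the second edge is unused and the sign flips.

module _ {A B : Set} where

  anyᵇ-tabulate : ∀ {M} (g : Fin M → A) (g' : Fin M → B) (p : A → Bool) (p' : B → Bool) →
    (∀ i → p (g i) ≡ p' (g' i)) → anyᵇ p (tabulate g) ≡ anyᵇ p' (tabulate g')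
  anyᵇ-tabulate {zero} g g' p p' eq = refl
  anyᵇ-tabulate {suc M} g g' p p' eq =
    cong₂ _∨_ (eq F.zero) (anyᵇ-tabulate (λ i → g (F.suc i)) (λ i → g' (F.suc i)) p p' (λ i → eq (F.suc i)))

  allᵇ-tabulate : ∀ {M} (g : Fin M → A) (g' : Fin M → B) (p : A → Bool) (p' : B → Bool) →
    (∀ i → p (g i) ≡ p' (g' i)) → allᵇ p (tabulate g) ≡ allᵇ p' (tabulate g')
  allᵇ-tabulate {zero} g g' p p' eq = refl
  allᵇ-tabulate {suc M} g g' p p' eq =
    cong₂ _∧_ (eq F.zero) (allᵇ-tabulate (λ i → g (F.suc i)) (λ i → g' (F.suc i)) p p' (λ i → eq (F.suc i)))

  prodℤ-tabulate : ∀ {M} (g : Fin M → A) (g' : Fin M → B) (f : A → ℤ) (f' : B → ℤ) →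
    (∀ i → f (g i) ≡ f' (g' i)) → prodℤ (map f (tabulate g)) ≡ prodℤ (map f' (tabulate g'))
  prodℤ-tabulate {zero} g g' f f' eq = refl
  prodℤ-tabulate {suc M} g g' f f' eq =
    cong₂ _*_ (eq F.zero) (prodℤ-tabulate (λ i → g (F.suc i)) (λ i → g' (F.suc i)) f f' (λ i → eq (F.suc i)))

module _ {A : Set} where

  anyᵇ-false : ∀ {M} (g : Fin M → A) (p : A → Bool) → (∀ i → p (g i) ≡ false) → anyᵇ p (tabulate g) ≡ false
  anyᵇ-false {zero} g p eq = refl
  anyᵇ-false {suc M} g p eq = cong₂ _∨_ (eq F.zero) (anyᵇ-false (λ i → g (F.suc i)) p (λ i → eq (F.suc i)))

  allᵇ-true : ∀ {M} (g : Fin M → A) (p : A → Bool) → (∀ i → p (g i) ≡ true) → allᵇ p (tabulate g) ≡ true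
  allᵇ-true {zero} g p eq = refl
  allᵇ-true {suc M} g p eq = cong₂ _∧_ (eq F.zero) (allᵇ-true (λ i → g (F.suc i)) p (λ i → eq (F.suc i)))

  allᵇ-∧ : (l : List A) (p q : A → Bool) → allᵇ (λ x → p x ∧ q x) l ≡ allᵇ p l ∧ allᵇ q l
  allᵇ-∧ [] p q = refl
  allᵇ-∧ (x ∷ l) p q rewrite allᵇ-∧ l p q with p x | q x
  ... | true | true = refl
  ... | true | false = sym (BoolP.∧-zeroʳ (allᵇ p l))
  ... | false | _ = refl

firstᵇ : ∀ {M} → Subset M → Bool
firstᵇ [] = false
firstᵇ (b ∷ _) = b

covered-zero : ∀ {M} b (s : Subset M) → coveredᵇ (b ∷ s) 0 ≡ b
covered-zero b s =
  trans (cong (b ∧ true ∨_) (anyᵇ-false F.suc (λ i → memᵇ i (b ∷ s) ∧ (ℕeqᵇ (toℕ i) 0 ∨ ℕeqᵇ (suc (toℕ i)) 0))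
                                         (λ i → BoolP.∧-zeroʳ (memᵇ (F.suc i) (b ∷ s)))))
        (trans (BoolP.∨-identityʳ (b ∧ true)) (BoolP.∧-identityʳ b))

covered-suc : ∀ {M} b (s : Subset M) v → coveredᵇ (b ∷ s) (suc v) ≡ (b ∧ ℕeqᵇ 0 v) ∨ coveredᵇ s v
covered-suc b s v = cong ((b ∧ ℕeqᵇ 0 v) ∨_)
  (anyᵇ-tabulate F.suc (λ i → i) (λ i → memᵇ i (b ∷ s) ∧ (ℕeqᵇ (toℕ i) (suc v) ∨ ℕeqᵇ (suc (toℕ i)) (suc v)))
                 (λ i → memᵇ i s ∧ (ℕeqᵇ (toℕ i) v ∨ ℕeqᵇ (suc (toℕ i)) v)) (λ i → refl))

matchTest : ∀ {M} → Bool → Subset M → Fin (suc M) → Fin (suc M) → Bool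
matchTest b s i j = not (memᵇ i (b ∷ s) ∧ memᵇ j (b ∷ s) ∧ not (eqᵇ i j)) ∨ disjointEdgesᵇ (toℕ i) (toℕ j)

-- edge 0 conflicts with edge j only for j = 1
firstRow : ∀ {M} b (s : Subset M) → allᵇ (matchTest b s F.zero) (tabulate F.suc) ≡ not (b ∧ firstᵇ s)
firstRow b [] = sym (cong not (BoolP.∧-zeroʳ b))
firstRow b (c ∷ s') rewrite allᵇ-true (λ j → F.suc (F.suc j)) (matchTest b (c ∷ s') F.zero)
                              (λ j → BoolP.∨-zeroʳ (not (b ∧ memᵇ (F.suc (F.suc j)) (b ∷ c ∷ s') ∧ true)))
                       with b | c
... | true | true = refl
... | true | false = refl
... | false | _ = refl

firstColumn : ∀ {M} b (s : Subset M) → allᵇ (λ i → matchTest b s (F.suc i) F.zero) (tabulate (λ i → i)) ≡ not (b ∧ firstᵇ s)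
firstColumn b [] = sym (cong not (BoolP.∧-zeroʳ b))
firstColumn b (c ∷ s') rewrite allᵇ-true F.suc (λ i → matchTest b (c ∷ s') (F.suc i) F.zero)
                                 (λ j → BoolP.∨-zeroʳ (not (memᵇ (F.suc (F.suc j)) (b ∷ c ∷ s') ∧ b ∧ true)))
                          with b | c
... | true | true = refl
... | true | false = refl
... | false | true = refl
... | false | false = refl

isMatching-cons : ∀ {M} b (s : Subset M) → isMatchingᵇ (b ∷ s) ≡ not (b ∧ firstᵇ s) ∧ isMatchingᵇ s
isMatching-cons {M} b s = begin
    isMatchingᵇ (b ∷ s)
  ≡⟨ cong₂ _∧_ (cong₂ _∧_ (diagonal b) (firstRow b s))
               (allᵇ-tabulate F.suc (λ i → i) row row' (λ i → cong (matchTest b s (F.suc i) F.zero ∧_)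
                  (allᵇ-tabulate F.suc (λ j → j) (matchTest b s (F.suc i)) (rowTest i) (λ j → refl)))) ⟩
    (true ∧ X) ∧ allᵇ row' (tabulate (λ i → i))
  ≡⟨ cong ((true ∧ X) ∧_) (allᵇ-∧ (tabulate (λ i → i)) (λ i → matchTest b s (F.suc i) F.zero) rowS) ⟩
    (true ∧ X) ∧ (allᵇ (λ i → matchTest b s (F.suc i) F.zero) (tabulate (λ i → i)) ∧ isMatchingᵇ s)
  ≡⟨ cong (λ t → (true ∧ X) ∧ (t ∧ isMatchingᵇ s)) (firstColumn b s) ⟩
    (true ∧ X) ∧ (X ∧ isMatchingᵇ s)
  ≡⟨ absorb X (isMatchingᵇ s) ⟩
    X ∧ isMatchingᵇ s
  ∎
  where
  open ≡-Reasoning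
  X : Bool
  X = not (b ∧ firstᵇ s)
  diagonal : ∀ b → matchTest b s F.zero F.zero ≡ true
  diagonal true = refl
  diagonal false = refl
  rowTest : Fin M → Fin M → Bool
  rowTest i j = not (memᵇ i s ∧ memᵇ j s ∧ not (eqᵇ i j)) ∨ disjointEdgesᵇ (toℕ i) (toℕ j)
  row : Fin (suc M) → Bool
  row i = allᵇ (matchTest b s i) (allFin (suc M))
  rowS : Fin M → Bool
  rowS i = allᵇ (rowTest i) (allFin M)
  row' : Fin M → Bool
  row' i = matchTest b s (F.suc i) F.zero ∧ rowS i
  absorb : ∀ x y → (true ∧ x) ∧ (x ∧ y) ≡ x ∧ y
  absorb true y = refl
  absorb false y = refl

weight : ∀ {M} → Subset M → List ℕ → ℤ
weight s ks = prodℤ (map (λ v → if coveredᵇ s (toℕ v) then + 1 else + (lookup ks v)) (allFin (length ks)))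

contribution : ∀ {M} → List ℕ → Subset M → ℤ
contribution ks μ = if isMatchingᵇ μ then signℤ ∣ μ ∣ * weight μ ks else +0

∑-filter : ∀ {M} (l : List (Subset M)) (p : Subset M → Bool) (f : Subset M → ℤ) →
  ∑ f (filter (λ μ → p μ Bool.≟ true) l) ≡ ∑ (λ μ → if p μ then f μ else +0) l
∑-filter [] p f = refl
∑-filter (x ∷ l) p f with p x
... | true = cong (_+_ (f x)) (∑-filter l p f)
... | false = trans (∑-filter l p f) (sym (ℤP.+-identityˡ _))

matchingFormula-subsets : ∀ ks → matchingFormula ks ≡ ∑ (contribution ks) (allSubsets (length ks ∸ 1))
matchingFormula-subsets ks = ∑-filter (allSubsets (length ks ∸ 1)) isMatchingᵇ _

∑-allSubsets-suc : ∀ {M} (l : List (Subset M)) (f : Subset (suc M) → ℤ) →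
  ∑ f (concatMap (λ s → (true ∷ s) ∷ (false ∷ s) ∷ []) l) ≡ ∑ (λ s → f (true ∷ s) + f (false ∷ s)) l
∑-allSubsets-suc [] f = refl
∑-allSubsets-suc (s ∷ l) f = trans (cong (λ t → f (true ∷ s) + (f (false ∷ s) + t)) (∑-allSubsets-suc l f))
                                   (sym (ℤP.+-assoc (f (true ∷ s)) (f (false ∷ s)) _))

weight-cons : ∀ {M} (s : Subset M) k ks → weight s (k ∷ ks) ≡
  (if coveredᵇ s 0 then + 1 else + k) * prodℤ (map (λ v → if coveredᵇ s (suc (toℕ v)) then + 1 else + (lookup ks v)) (allFin (length ks)))
weight-cons s k ks = cong ((if coveredᵇ s 0 then + 1 else + k) *_)
  (prodℤ-tabulate F.suc (λ i → i) (λ v → if coveredᵇ s (toℕ v) then + 1 else + (lookup (k ∷ ks) v))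
                                  (λ v → if coveredᵇ s (suc (toℕ v)) then + 1 else + (lookup ks v)) (λ i → refl))

-- matchings avoiding the first edge: vertex 0 is uncovered
contribution-false : ∀ {M} (s : Subset M) k ks → contribution (k ∷ ks) (false ∷ s) ≡ + k * contribution ks s
contribution-false s k ks rewrite isMatching-cons false s with isMatchingᵇ s
... | false = sym (ℤP.*-zeroʳ (+ k))
... | true = trans (cong (signℤ ∣ s ∣ *_) (trans (weight-cons (false ∷ s) k ks)
                      (cong₂ _*_ (cong (λ b → if b then + 1 else + k) (covered-zero false s))
                                 (prodℤ-tabulate (λ i → i) (λ i → i) _ _
                                    (λ v → cong (λ b → if b then + 1 else + lookup ks v) (covered-suc false s (toℕ v)))))))
                (swap (signℤ ∣ s ∣) (+ k) (weight s ks))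
  where
  swap : ∀ a k w → a * (k * w) ≡ k * (a * w)
  swap = solve-∀

-- with the first edge used, vertices 0 and 1 are covered
weight-true : ∀ {M} (s : Subset M) k₁ k₂ r → weight (true ∷ s) (k₁ ∷ k₂ ∷ r) ≡
  prodℤ (map (λ v → if coveredᵇ s (suc (toℕ v)) then + 1 else + (lookup r v)) (allFin (length r)))
weight-true s k₁ k₂ r = trans (weight-cons (true ∷ s) k₁ (k₂ ∷ r))
  (trans (cong₂ _*_ (cong (λ b → if b then + 1 else + k₁) (covered-zero true s)) refl)
  (trans (ℤP.*-identityˡ _)
  (trans (prodℤ-tabulate (λ i → i) (λ i → i) _ (λ v → if (ℕeqᵇ 0 (toℕ v) ∨ coveredᵇ s (toℕ v)) then + 1 else + (lookup (k₂ ∷ r) v))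
           (λ v → cong (λ b → if b then + 1 else + lookup (k₂ ∷ r) v) (covered-suc true s (toℕ v))))
  (trans (ℤP.*-identityˡ _)
    (prodℤ-tabulate F.suc (λ i → i) (λ v → if (ℕeqᵇ 0 (toℕ v) ∨ coveredᵇ s (toℕ v)) then + 1 else + (lookup (k₂ ∷ r) v))
       (λ v → if coveredᵇ s (suc (toℕ v)) then + 1 else + (lookup r v)) (λ i → refl))))))

firstEdgeUsed : ∀ k₁ k₂ r → ∑ (λ s → contribution (k₁ ∷ k₂ ∷ r) (true ∷ s)) (allSubsets (length r)) ≡ - matchingFormula r
firstEdgeUsed k₁ k₂ [] = refl
firstEdgeUsed k₁ k₂ (r₀ ∷ r) = trans (∑-allSubsets-suc (allSubsets (length r)) (λ s → contribution (k₁ ∷ k₂ ∷ r₀ ∷ r) (true ∷ s)))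
  (trans (∑-cong (allSubsets (length r)) perSubset)
  (trans (∑-*ˡ (allSubsets (length r)) (- + 1) (contribution (r₀ ∷ r)))
  (trans (ℤP.-1*i≡-i _) (cong -_ (sym (matchingFormula-subsets (r₀ ∷ r)))))))
  where
  perSubset : ∀ s → contribution (k₁ ∷ k₂ ∷ r₀ ∷ r) (true ∷ true ∷ s) + contribution (k₁ ∷ k₂ ∷ r₀ ∷ r) (true ∷ false ∷ s)
                    ≡ - + 1 * contribution (r₀ ∷ r) s
  perSubset s rewrite isMatching-cons true (true ∷ s) | isMatching-cons true (false ∷ s) | isMatching-cons false s
    with isMatchingᵇ s
  ... | false = refl
  ... | true = trans (ℤP.+-identityˡ _)
      (trans (cong (λ t → - signℤ ∣ s ∣ * t) (trans (weight-true (false ∷ s) k₁ k₂ (r₀ ∷ r))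
         (prodℤ-tabulate (λ i → i) (λ i → i) _ _ (λ v → cong (λ b → if b then + 1 else + lookup (r₀ ∷ r) v) (covered-suc false s (toℕ v))))))
         (negate (signℤ ∣ s ∣) (weight s (r₀ ∷ r))))
    where
    negate : ∀ a w → - a * w ≡ - + 1 * (a * w)
    negate = solve-∀

matchingFormula-rec : ∀ k₁ k₂ r → matchingFormula (k₁ ∷ k₂ ∷ r) ≡ + k₁ * matchingFormula (k₂ ∷ r) - matchingFormula r
matchingFormula-rec k₁ k₂ r = begin
    matchingFormula (k₁ ∷ k₂ ∷ r)
  ≡⟨ matchingFormula-subsets (k₁ ∷ k₂ ∷ r) ⟩
    ∑ (contribution (k₁ ∷ k₂ ∷ r)) (allSubsets (suc (length r)))
  ≡⟨ ∑-allSubsets-suc (allSubsets (length r)) (contribution (k₁ ∷ k₂ ∷ r)) ⟩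
    ∑ (λ s → contribution (k₁ ∷ k₂ ∷ r) (true ∷ s) + contribution (k₁ ∷ k₂ ∷ r) (false ∷ s)) (allSubsets (length r))
  ≡⟨ ∑-+ (allSubsets (length r)) _ _ ⟩
    ∑ (λ s → contribution (k₁ ∷ k₂ ∷ r) (true ∷ s)) (allSubsets (length r))
      + ∑ (λ s → contribution (k₁ ∷ k₂ ∷ r) (false ∷ s)) (allSubsets (length r))
  ≡⟨ cong₂ _+_ (firstEdgeUsed k₁ k₂ r) firstEdgeUnused ⟩
    - matchingFormula r + + k₁ * matchingFormula (k₂ ∷ r)
  ≡⟨ ℤP.+-comm (- matchingFormula r) _ ⟩
    + k₁ * matchingFormula (k₂ ∷ r) - matchingFormula r
  ∎
  where
  open ≡-Reasoning
  firstEdgeUnused : ∑ (λ s → contribution (k₁ ∷ k₂ ∷ r) (false ∷ s)) (allSubsets (length r)) ≡ + k₁ * matchingFormula (k₂ ∷ r)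
  firstEdgeUnused = trans (∑-cong (allSubsets (length r)) (λ s → contribution-false s k₁ (k₂ ∷ r)))
    (trans (∑-*ˡ (allSubsets (length r)) (+ k₁) _) (cong (+ k₁ *_) (sym (matchingFormula-subsets (k₂ ∷ r)))))

matchingFormula-single : ∀ k → matchingFormula (k ∷ []) ≡ + k
matchingFormula-single k = trans (ℤP.+-identityʳ _) (trans (ℤP.*-identityˡ _) (ℤP.*-identityʳ (+ k)))

-- Continuants:  K(k₁ … kₙ)  and  K(k₁ … kₙ₋₁)  (the numerator and the
-- "initial" continuant).  Both satisfy the same front recursion, and adding a
-- polygon at the back updates them by  (K, K⁻) ↦ (k K - K⁻, K).
continuant : List ℕ → ℤ
continuant [] = + 1
continuant (k ∷ []) = + k
continuant (k ∷ k' ∷ r) = + k * continuant (k' ∷ r) - continuant r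

continuant⁻ : List ℕ → ℤ
continuant⁻ [] = +0
continuant⁻ (k ∷ []) = + 1
continuant⁻ (k ∷ k' ∷ r) = + k * continuant⁻ (k' ∷ r) - continuant⁻ r

matchingFormula≡continuant : ∀ ks → matchingFormula ks ≡ continuant ks
matchingFormula≡continuant [] = refl
matchingFormula≡continuant (k ∷ []) = matchingFormula-single k
matchingFormula≡continuant (k ∷ k' ∷ r) =
  trans (matchingFormula-rec k k' r) (cong₂ (λ x y → + k * x - y) (matchingFormula≡continuant (k' ∷ r)) (matchingFormula≡continuant r))

continuant-snoc : ∀ ks k → continuant (ks ++ [ k ]) ≡ + k * continuant ks - continuant⁻ ks
continuant-snoc [] k = sym (trans (ℤP.+-identityʳ _) (ℤP.*-identityʳ (+ k)))
continuant-snoc (k₁ ∷ []) k = cong (_- + 1) (ℤP.*-comm (+ k₁) (+ k))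
continuant-snoc (k₁ ∷ k₂ ∷ r) k rewrite continuant-snoc (k₂ ∷ r) k | continuant-snoc r k =
  regroup (+ k₁) (+ k) (continuant (k₂ ∷ r)) (continuant⁻ (k₂ ∷ r)) (continuant r) (continuant⁻ r)
  where
  regroup : ∀ k₁ k c₂ i₂ c i → k₁ * (k * c₂ - i₂) - (k * c - i) ≡ k * (k₁ * c₂ - c) - (k₁ * i₂ - i)
  regroup = solve-∀

continuant⁻-snoc : ∀ ks k → continuant⁻ (ks ++ [ k ]) ≡ continuant ks
continuant⁻-snoc [] k = refl
continuant⁻-snoc (k₁ ∷ []) k = trans (ℤP.+-identityʳ _) (ℤP.*-identityʳ (+ k₁))
continuant⁻-snoc (k₁ ∷ k₂ ∷ r) k rewrite continuant⁻-snoc (k₂ ∷ r) k | continuant⁻-snoc r k = refl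

mem : ∀ {n} → Subset n → Fin n → Set
mem S e = V.lookup S e ≡ true

mem⇒∈ : ∀ {n} {S : Subset n} {e} → mem S e → e ∈ S
mem⇒∈ {S = S} {e} = VP.lookup⇒[]= e S

∈⇒mem : ∀ {n} {S : Subset n} {e} → e ∈ S → mem S e
∈⇒mem = VP.[]=⇒lookup

lookup-∖ : ∀ {n} (S : Subset n) (x y : Fin n) → V.lookup (S ∖ x) y ≡ V.lookup S y ∧ not (eqᵇ y x)
lookup-∖ (true ∷ S) F.zero F.zero = refl
lookup-∖ (false ∷ S) F.zero F.zero = refl
lookup-∖ (b ∷ S) F.zero (F.suc y) = trans (removeNothing _ (λ x → refl) S y) (sym (BoolP.∧-identityʳ _))
  where
  removeNothing : ∀ {n} (d : Bool → Bool → Bool) → (∀ x → d x false ≡ x) → (S : Subset n) (y : Fin n) →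
    V.lookup (V.zipWith d S (V.replicate n false)) y ≡ V.lookup S y
  removeNothing d d-false (c ∷ S) F.zero = d-false c
  removeNothing d d-false (c ∷ S) (F.suc y) = removeNothing d d-false S y
lookup-∖ (true ∷ S) (F.suc x) F.zero = refl
lookup-∖ (false ∷ S) (F.suc x) F.zero = refl
lookup-∖ (b ∷ S) (F.suc x) (F.suc y) = lookup-∖ S x y

∖-⊆ : ∀ {n} {S : Subset n} {x y} → mem (S ∖ x) y → mem S y
∖-⊆ {S = S} {x} {y} p with V.lookup S y in h
... | true = refl
... | false = trans (sym (trans (lookup-∖ S x y) (cong (_∧ not (eqᵇ y x)) h))) p

∖-keep : ∀ {n} {S : Subset n} {x y} → mem S y → y ≢ x → mem (S ∖ x) y
∖-keep {S = S} {x} {y} p y≢x = trans (lookup-∖ S x y) (cong₂ _∧_ p (cong not (eqᵇ-false y≢x)))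

∖-removed : ∀ {n} (S : Subset n) x → V.lookup (S ∖ x) x ≡ false
∖-removed S x = trans (lookup-∖ S x x) (trans (cong (λ b → V.lookup S x ∧ not b) (eqᵇ-refl x)) (BoolP.∧-zeroʳ _))

vecExt : ∀ {n} {A : Set} (S S' : Vec A n) → (∀ i → V.lookup S i ≡ V.lookup S' i) → S ≡ S'
vecExt S S' eq = trans (sym (VP.tabulate∘lookup S)) (trans (VP.tabulate-cong eq) (VP.tabulate∘lookup S'))

true≢false : true ≢ false
true≢false ()

true⇒¬false : ∀ {b} → b ≡ true → b ≢ false
true⇒¬false refl ()

¬false⇒true : ∀ {b} → b ≢ false → b ≡ true
¬false⇒true {true} _ = refl
¬false⇒true {false} h = ⊥-elim (h refl)

module Walks (G : Graph) where
  private
    E : ℕ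
    E = length (edges G)

  src tgt : Fin E → Fin (nv G)
  src e = proj₁ (lookup (edges G) e)
  tgt e = proj₂ (lookup (edges G) e)

  edgeWalk : ∀ {S : Subset E} e → mem S e → Reach G S (src e) (tgt e)
  edgeWalk e p = fwd e (mem⇒∈ p) here

  walk-trans : ∀ {S x y z} → Reach G S x y → Reach G S y z → Reach G S x z
  walk-trans r here = r
  walk-trans r (fwd e p r') = fwd e p (walk-trans r r')
  walk-trans r (bwd e p r') = bwd e p (walk-trans r r')

  walk-sym : ∀ {S x y} → Reach G S x y → Reach G S y x
  walk-sym here = here
  walk-sym (fwd e p r) = walk-trans (bwd e p here) (walk-sym r)
  walk-sym (bwd e p r) = walk-trans (fwd e p here) (walk-sym r)

  colour-invariant : ∀ {S} (c : Fin (nv G) → Bool) → (∀ e → mem S e → c (src e) ≡ c (tgt e)) →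
    ∀ {x y} → Reach G S x y → c x ≡ c y
  colour-invariant c h here = refl
  colour-invariant c h (fwd e p r) = trans (colour-invariant c h r) (h e (∈⇒mem p))
  colour-invariant c h (bwd e p r) = trans (colour-invariant c h r) (sym (h e (∈⇒mem p)))

open Walks public using (walk-trans; walk-sym; edgeWalk; colour-invariant)

transfer : (G H : Graph) (S : Subset (length (edges G))) (T : Subset (length (edges H)))
  (f : Fin (nv G) → Fin (nv H)) →
  (∀ e → mem S e → Reach H T (f (proj₁ (lookup (edges G) e))) (f (proj₂ (lookup (edges G) e)))) →
  ∀ {x y} → Reach G S x y → Reach H T (f x) (f y)
transfer G H S T f h here = here
transfer G H S T f h (fwd e p r) = walk-trans H (transfer G H S T f h r) (h e (∈⇒mem p))
transfer G H S T f h (bwd e p r) = walk-trans H (transfer G H S T f h r) (walk-sym H (h e (∈⇒mem p)))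

module _ {A : Set} where
  inL : (xs ys : List A) → Fin (length xs) → Fin (length (xs ++ ys))
  inL (x ∷ xs) ys F.zero = F.zero
  inL (x ∷ xs) ys (F.suc i) = F.suc (inL xs ys i)

  inR : (xs ys : List A) → Fin (length ys) → Fin (length (xs ++ ys))
  inR [] ys j = j
  inR (x ∷ xs) ys j = F.suc (inR xs ys j)

  splitIndex : (xs ys : List A) → Fin (length (xs ++ ys)) → Fin (length xs) ⊎ Fin (length ys)
  splitIndex [] ys e = inj₂ e
  splitIndex (x ∷ xs) ys F.zero = inj₁ F.zero
  splitIndex (x ∷ xs) ys (F.suc e) = Sum.map₁ F.suc (splitIndex xs ys e)

  splitIndex-inL : ∀ xs ys i → splitIndex xs ys (inL xs ys i) ≡ inj₁ i
  splitIndex-inL (x ∷ xs) ys F.zero = refl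
  splitIndex-inL (x ∷ xs) ys (F.suc i) rewrite splitIndex-inL xs ys i = refl

  splitIndex-inR : ∀ xs ys j → splitIndex xs ys (inR xs ys j) ≡ inj₂ j
  splitIndex-inR [] ys j = refl
  splitIndex-inR (x ∷ xs) ys j rewrite splitIndex-inR xs ys j = refl

  joinIndex : ∀ xs ys e → [ inL xs ys , inR xs ys ]′ (splitIndex xs ys e) ≡ e
  joinIndex [] ys e = refl
  joinIndex (x ∷ xs) ys F.zero = refl
  joinIndex (x ∷ xs) ys (F.suc e) with splitIndex xs ys e | joinIndex xs ys e
  ... | inj₁ i | eq = cong F.suc eq
  ... | inj₂ j | eq = cong F.suc eq

  lookup-inL : ∀ xs ys i → lookup (xs ++ ys) (inL xs ys i) ≡ lookup xs i
  lookup-inL (x ∷ xs) ys F.zero = refl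
  lookup-inL (x ∷ xs) ys (F.suc i) = lookup-inL xs ys i

  lookup-inR : ∀ xs ys j → lookup (xs ++ ys) (inR xs ys j) ≡ lookup ys j
  lookup-inR [] ys j = refl
  lookup-inR (x ∷ xs) ys j = lookup-inR xs ys j

  inL-injective : ∀ xs ys {i j} → inL xs ys i ≡ inL xs ys j → i ≡ j
  inL-injective xs ys {i} {j} eq =
    SumP.inj₁-injective (trans (sym (splitIndex-inL xs ys i)) (trans (cong (splitIndex xs ys) eq) (splitIndex-inL xs ys j)))

  inR-injective : ∀ xs ys {i j} → inR xs ys i ≡ inR xs ys j → i ≡ j
  inR-injective xs ys {i} {j} eq =
    SumP.inj₂-injective (trans (sym (splitIndex-inR xs ys i)) (trans (cong (splitIndex xs ys) eq) (splitIndex-inR xs ys j)))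

  inL≢inR : ∀ xs ys i j → inL xs ys i ≢ inR xs ys j
  inL≢inR xs ys i j eq with trans (sym (splitIndex-inL xs ys i)) (trans (cong (splitIndex xs ys) eq) (splitIndex-inR xs ys j))
  ... | ()

module _ {A B : Set} (f : A → B) where
  mapIndex : (l : List A) → Fin (length l) → Fin (length (map f l))
  mapIndex (x ∷ l) F.zero = F.zero
  mapIndex (x ∷ l) (F.suc i) = F.suc (mapIndex l i)

  unmapIndex : (l : List A) → Fin (length (map f l)) → Fin (length l)
  unmapIndex (x ∷ l) F.zero = F.zero
  unmapIndex (x ∷ l) (F.suc i) = F.suc (unmapIndex l i)

  unmap∘map : ∀ l i → unmapIndex l (mapIndex l i) ≡ i
  unmap∘map (x ∷ l) F.zero = refl
  unmap∘map (x ∷ l) (F.suc i) = cong F.suc (unmap∘map l i)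

  map∘unmap : ∀ l i → mapIndex l (unmapIndex l i) ≡ i
  map∘unmap (x ∷ l) F.zero = refl
  map∘unmap (x ∷ l) (F.suc i) = cong F.suc (map∘unmap l i)

  lookup-mapIndex : ∀ l i → lookup (map f l) (mapIndex l i) ≡ f (lookup l i)
  lookup-mapIndex (x ∷ l) F.zero = refl
  lookup-mapIndex (x ∷ l) (F.suc i) = lookup-mapIndex l i

-- The edge set of G' = extendedGraph G u w m is  (old edges) ++ (path edges),
-- so an edge subset of G' is a pair (S, P) of an edge subset S of G and a
-- boolean for each of the m+1 path edges:  combine S P.

ltb : ℕ → ℕ → Bool
ltb a b = does (a ℕ.<? b)

ltb-true : ∀ {a b} → a < b → ltb a b ≡ true
ltb-true {a} {b} = dec-true (a ℕ.<? b)

ltb-false : ∀ {a b} → ¬ a < b → ltb a b ≡ false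
ltb-false {a} {b} = dec-false (a ℕ.<? b)

ltb-sucʳ : ∀ {a b} → a ≢ b → ltb a (suc b) ≡ ltb a b
ltb-sucʳ {a} {b} a≢b with a ℕ.<? b
... | yes a<b = trans (ltb-true (ℕP.m≤n⇒m≤1+n a<b)) (sym (ltb-true a<b))
... | no a≮b = trans (ltb-false λ a<1+b → a≮b (ℕP.≤∧≢⇒< (ℕP.≤-pred a<1+b) a≢b)) (sym (ltb-false a≮b))

ltb-sucˡ : ∀ {a b} → suc a ≢ b → ltb a b ≡ ltb (suc a) b
ltb-sucˡ {a} {b} 1+a≢b with suc a ℕ.<? b
... | yes 1+a<b = trans (ltb-true (ℕP.<-trans (ℕP.n<1+n a) 1+a<b)) (sym (ltb-true 1+a<b))
... | no 1+a≮b = trans (ltb-false λ a<b → 1+a≮b (ℕP.≤∧≢⇒< a<b 1+a≢b)) (sym (ltb-false 1+a≮b))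

module EdgeSplit (G : Graph) (u w : Fin (nv G)) (m : ℕ) where
  open PathExtension G u w m public

  E E' K : ℕ
  E = length (edges G)
  E' = length (edges G')
  K = length (consecPairs L)

  private
    oldEdges' pathEdges' : List (Fin (n ℕ.+ m) × Fin (n ℕ.+ m))
    oldEdges' = map (liftEdge m) (edges G)
    pathEdges' = consecPairs L

  K≡ : K ≡ suc m
  K≡ = trans (length-consecPairs L) pathLength

  oldEdge : Fin E → Fin E'
  oldEdge e = inL oldEdges' pathEdges' (mapIndex (liftEdge m) (edges G) e)

  pathEdge : Fin K → Fin E'
  pathEdge i = inR oldEdges' pathEdges' i

  lookup-oldEdge : ∀ e → lookup (edges G') (oldEdge e) ≡ liftEdge m (lookup (edges G) e)
  lookup-oldEdge e = trans (lookup-inL oldEdges' pathEdges' _) (lookup-mapIndex (liftEdge m) (edges G) e)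

  lookup-pathEdge : ∀ i → lookup (edges G') (pathEdge i) ≡ (q (toℕ i) , q (suc (toℕ i)))
  lookup-pathEdge i = trans (lookup-inR oldEdges' pathEdges' i) (lookup-consecPairs L (u ↑ˡ m) i)

  data EdgeKind : Fin E' → Set where
    oldKind : ∀ e → EdgeKind (oldEdge e)
    pathKind : ∀ i → EdgeKind (pathEdge i)

  edgeKind : ∀ e' → EdgeKind e'
  edgeKind e' = go (splitIndex oldEdges' pathEdges' e') (joinIndex oldEdges' pathEdges' e')
    where
    go : ∀ s → [ inL oldEdges' pathEdges' , inR oldEdges' pathEdges' ]′ s ≡ e' → EdgeKind e'
    go (inj₁ k) refl = subst (λ k' → EdgeKind (inL oldEdges' pathEdges' k')) (map∘unmap (liftEdge m) (edges G) k)
                             (oldKind (unmapIndex (liftEdge m) (edges G) k))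
    go (inj₂ i) refl = pathKind i

  oldEdge-injective : ∀ {e e'} → oldEdge e ≡ oldEdge e' → e ≡ e'
  oldEdge-injective {e} {e'} eq =
    trans (sym (unmap∘map (liftEdge m) (edges G) e))
          (trans (cong (unmapIndex (liftEdge m) (edges G)) (inL-injective oldEdges' pathEdges' eq)) (unmap∘map (liftEdge m) (edges G) e'))

  pathEdge-injective : ∀ {i i'} → pathEdge i ≡ pathEdge i' → i ≡ i'
  pathEdge-injective = inR-injective oldEdges' pathEdges'

  oldEdge≢pathEdge : ∀ e i → oldEdge e ≢ pathEdge i
  oldEdge≢pathEdge e i = inL≢inR oldEdges' pathEdges' _ i

  combine : Subset E → (Fin K → Bool) → Subset E'
  combine S P = V.tabulate (λ e' → [ (λ k → V.lookup S (unmapIndex (liftEdge m) (edges G) k)) , P ]′ (splitIndex oldEdges' pathEdges' e'))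

  combine-old : ∀ S P e → V.lookup (combine S P) (oldEdge e) ≡ V.lookup S e
  combine-old S P e = trans (VP.lookup∘tabulate _ (oldEdge e))
    (trans (cong [ (λ k → V.lookup S (unmapIndex (liftEdge m) (edges G) k)) , P ]′ (splitIndex-inL oldEdges' pathEdges' _))
           (cong (V.lookup S) (unmap∘map (liftEdge m) (edges G) e)))

  combine-path : ∀ S P i → V.lookup (combine S P) (pathEdge i) ≡ P i
  combine-path S P i = trans (VP.lookup∘tabulate _ (pathEdge i))
    (cong [ (λ k → V.lookup S (unmapIndex (liftEdge m) (edges G) k)) , P ]′ (splitIndex-inR oldEdges' pathEdges' i))

  oldPart : Subset E' → Subset E
  oldPart S' = V.tabulate (λ e → V.lookup S' (oldEdge e))

  pathPart : Subset E' → Fin K → Bool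
  pathPart S' i = V.lookup S' (pathEdge i)

  combine-ext : ∀ S' S P → (∀ e → V.lookup S' (oldEdge e) ≡ V.lookup S e) → (∀ i → V.lookup S' (pathEdge i) ≡ P i) → S' ≡ combine S P
  combine-ext S' S P on-old on-path = vecExt S' (combine S P) λ e' → go e' (edgeKind e')
    where
    go : ∀ e' → EdgeKind e' → V.lookup S' e' ≡ V.lookup (combine S P) e'
    go _ (oldKind e) = trans (on-old e) (sym (combine-old S P e))
    go _ (pathKind i) = trans (on-path i) (sym (combine-path S P i))

  combine-cong : ∀ S P P' → (∀ i → P i ≡ P' i) → combine S P ≡ combine S P'
  combine-cong S P P' eq = combine-ext (combine S P) S P' (combine-old S P) (λ i → trans (combine-path S P i) (eq i))

  decompose : ∀ S' → S' ≡ combine (oldPart S') (pathPart S')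
  decompose S' = combine-ext S' (oldPart S') (pathPart S') (λ e → sym (VP.lookup∘tabulate _ e)) (λ i → refl)

  combine-injective : ∀ {S P S₂ P₂} → combine S P ≡ combine S₂ P₂ → S ≡ S₂ × (∀ i → P i ≡ P₂ i)
  combine-injective {S} {P} {S₂} {P₂} eq =
    vecExt S S₂ (λ e → trans (sym (combine-old S P e)) (trans (cong (λ X → V.lookup X (oldEdge e)) eq) (combine-old S₂ P₂ e))) ,
    (λ i → trans (sym (combine-path S P i)) (trans (cong (λ X → V.lookup X (pathEdge i)) eq) (combine-path S₂ P₂ i)))

  combine-∖-old : ∀ S P e → combine S P ∖ oldEdge e ≡ combine (S ∖ e) P
  combine-∖-old S P e = combine-ext (combine S P ∖ oldEdge e) (S ∖ e) P
    (λ e' → trans (lookup-∖ (combine S P) (oldEdge e) (oldEdge e'))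
       (trans (cong₂ _∧_ (combine-old S P e') (cong not (eqᵇ-inj oldEdge oldEdge-injective e' e))) (sym (lookup-∖ S e e'))))
    (λ i → trans (lookup-∖ (combine S P) (oldEdge e) (pathEdge i))
       (trans (cong₂ _∧_ (combine-path S P i) (cong not (eqᵇ-false (λ eq → oldEdge≢pathEdge e i (sym eq))))) (BoolP.∧-identityʳ (P i))))

  combine-∖-path : ∀ S P i → combine S P ∖ pathEdge i ≡ combine S (λ i' → P i' ∧ not (eqᵇ i' i))
  combine-∖-path S P i = combine-ext (combine S P ∖ pathEdge i) S (λ i' → P i' ∧ not (eqᵇ i' i))
    (λ e → trans (lookup-∖ (combine S P) (pathEdge i) (oldEdge e))
       (trans (cong₂ _∧_ (combine-old S P e) (cong not (eqᵇ-false (oldEdge≢pathEdge e i)))) (BoolP.∧-identityʳ (V.lookup S e))))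
    (λ i' → trans (lookup-∖ (combine S P) (pathEdge i) (pathEdge i'))
       (cong₂ _∧_ (combine-path S P i') (cong not (eqᵇ-inj pathEdge pathEdge-injective i' i))))

  pathIndex : ∀ t → t < suc m → Fin K
  pathIndex t p = F.fromℕ< (subst (t <_) (sym K≡) p)

  toℕ-pathIndex : ∀ t p → toℕ (pathIndex t p) ≡ t
  toℕ-pathIndex t p = FP.toℕ-fromℕ< _

  toℕ<K : ∀ (i : Fin K) → toℕ i < suc m
  toℕ<K i = subst (toℕ i <_) K≡ (FP.toℕ<n i)

  ι : Fin n → Fin (n ℕ.+ m)
  ι x = x ↑ˡ m

  pathWalk : ∀ (S : Subset E) (P : Fin K → Bool) lo hi → lo ≤ hi → hi ≤ suc m →
    (∀ i → lo ≤ toℕ i → toℕ i < hi → P i ≡ true) → Reach G' (combine S P) (q lo) (q hi)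
  pathWalk S P lo zero z≤n _ h = here
  pathWalk S P lo (suc h) lo≤ h< present with ℕP.m≤n⇒m<n∨m≡n lo≤
  ... | inj₂ refl = here
  ... | inj₁ (s≤s lo≤h) =
    walk-trans G' (pathWalk S P lo h lo≤h (ℕP.≤-trans (ℕP.n≤1+n h) h<) (λ i a b → present i a (ℕP.m≤n⇒m≤1+n b)))
      (subst₂ (Reach G' (combine S P)) src≡ tgt≡
        (edgeWalk G' (pathEdge i) (trans (combine-path S P i)
          (present i (subst (lo ≤_) (sym toℕi) lo≤h) (subst (_< suc h) (sym toℕi) ℕP.≤-refl)))))
    where
    i : Fin K
    i = pathIndex h h<
    toℕi : toℕ i ≡ h
    toℕi = toℕ-pathIndex h h<
    src≡ : proj₁ (lookup (edges G') (pathEdge i)) ≡ q h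
    src≡ = trans (cong proj₁ (lookup-pathEdge i)) (cong q toℕi)
    tgt≡ : proj₂ (lookup (edges G') (pathEdge i)) ≡ q (suc h)
    tgt≡ = trans (cong proj₂ (lookup-pathEdge i)) (cong (λ t → q (suc t)) toℕi)

  oldEdgeWalk : ∀ S P e → V.lookup S e ≡ true → Reach G' (combine S P) (ι (proj₁ (lookup (edges G) e))) (ι (proj₂ (lookup (edges G) e)))
  oldEdgeWalk S P e p = subst₂ (Reach G' (combine S P)) (cong proj₁ (lookup-oldEdge e)) (cong proj₂ (lookup-oldEdge e))
                          (edgeWalk G' (oldEdge e) (trans (combine-old S P e) p))

module Connectivity (G : Graph) (u w : Fin (nv G)) (m : ℕ) where
  open EdgeSplit G u w m public

  -- Collapsing the new vertices before path edge j onto u and the others onto w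
  -- maps walks of G' to walks of G; path edge j becomes a u–w connection.
  module Collapse (j : ℕ) (j≤m : j ≤ m) where
    π : Fin (n ℕ.+ m) → Fin n
    π v = [ (λ x → x) , (λ t → if ltb (toℕ t) j then u else w) ]′ (splitAt n v)

    π-old : ∀ x → π (ι x) ≡ x
    π-old x = cong [ (λ x → x) , (λ t → if ltb (toℕ t) j then u else w) ]′ (FP.splitAt-↑ˡ n x m)

    π-new : ∀ t → π (n ↑ʳ t) ≡ (if ltb (toℕ t) j then u else w)
    π-new t = cong [ (λ x → x) , (λ t → if ltb (toℕ t) j then u else w) ]′ (FP.splitAt-↑ʳ n m t)

    π-before : ∀ s → s ≤ j → π (q s) ≡ u
    π-before zero _ = π-old u
    π-before (suc t) p with q-middle t (ℕP.<-≤-trans p j≤m)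
    ... | t' , t'≡t , eq rewrite eq | π-new t' | t'≡t | ltb-true {t} {j} p = refl

    π-after : ∀ s → j < s → s ≤ suc m → π (q s) ≡ w
    π-after (suc t) p (s≤s t≤m) with ℕP.m≤n⇒m<n∨m≡n t≤m
    ... | inj₂ refl rewrite q-last = π-old w
    ... | inj₁ t<m with q-middle t t<m
    ...   | t' , t'≡t , eq rewrite eq | π-new t' | t'≡t | ltb-false {t} {j} (λ t<j → ℕP.<⇒≱ t<j (ℕP.≤-pred p)) = refl

    connected-down : ∀ (X S : Subset E) (P : Fin K → Bool) →
      (∀ e → mem S e → mem X e) →
      (∀ i → P i ≡ true → toℕ i ≡ j → Reach G X u w) →
      Connected G' (combine S P) → Connected G X
    connected-down X S P S⊆X edge-j conn x y =
      subst₂ (Reach G X) (π-old x) (π-old y) (transfer G' G (combine S P) X π collapse (conn (ι x) (ι y)))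
      where
      collapse : ∀ e' → mem (combine S P) e' → Reach G X (π (proj₁ (lookup (edges G') e'))) (π (proj₂ (lookup (edges G') e')))
      collapse e' = go e' (edgeKind e')
        where
        go : ∀ e' → EdgeKind e' → mem (combine S P) e' → Reach G X (π (proj₁ (lookup (edges G') e'))) (π (proj₂ (lookup (edges G') e')))
        go _ (oldKind e) present rewrite lookup-oldEdge e | π-old (proj₁ (lookup (edges G) e)) | π-old (proj₂ (lookup (edges G) e)) =
          edgeWalk G e (S⊆X e (trans (sym (combine-old S P e)) present))
        go _ (pathKind i) present rewrite lookup-pathEdge i with ℕP.<-cmp (toℕ i) j
        ... | tri< i<j _ _ rewrite π-before (toℕ i) (ℕP.<⇒≤ i<j) | π-before (suc (toℕ i)) i<j = here
        ... | tri≈ _ i≡j _ rewrite π-before (toℕ i) (ℕP.≤-reflexive i≡j) | π-after (suc (toℕ i)) (s≤s (ℕP.≤-reflexive (sym i≡j))) (toℕ<K i) =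
              edge-j i (trans (sym (combine-path S P i)) present) i≡j
        ... | tri> _ _ i>j rewrite π-after (toℕ i) i>j (ℕP.<⇒≤ (toℕ<K i)) | π-after (suc (toℕ i)) (ℕP.m≤n⇒m≤1+n i>j) (toℕ<K i) = here

  connected-up : ∀ (X S : Subset E) (P : Fin K → Bool) →
    Connected G X →
    (∀ e → mem X e → Reach G' (combine S P) (ι (proj₁ (lookup (edges G) e))) (ι (proj₂ (lookup (edges G) e)))) →
    (∀ t → Σ (Fin n) λ x → Reach G' (combine S P) (n ↑ʳ t) (ι x)) →
    Connected G' (combine S P)
  connected-up X S P connX lift reachNew a b =
    walk-trans G' (proj₂ (toOld a)) (walk-trans G' (transfer G G' X (combine S P) ι lift (connX _ _)) (walk-sym G' (proj₂ (toOld b))))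
    where
    toOld : ∀ v → Σ (Fin n) λ x → Reach G' (combine S P) v (ι x)
    toOld v with vertexView n m v
    ... | old x = x , here
    ... | new t = reachNew t

  -- If two path edges i < i' are missing, the new vertices strictly between them
  -- are cut off:  colour them, and no present edge changes colour.
  twoMissing : ∀ (S : Subset E) (P : Fin K → Bool) i i' → P i ≡ false → P i' ≡ false → toℕ i < toℕ i' →
    ¬ Connected G' (combine S P)
  twoMissing S P i i' Pi Pi' i<i' conn = differ (colour-invariant G' colour preserved (conn (q (suc I)) (q 0)))
    where
    I I' : ℕ
    I = toℕ i
    I' = toℕ i'
    I'≤m : I' ≤ m
    I'≤m = ℕP.≤-pred (toℕ<K i')
    colour : Fin (n ℕ.+ m) → Bool
    colour v = [ (λ _ → false) , (λ t → ltb I (suc (toℕ t)) ∧ ltb (toℕ t) I') ]′ (splitAt n v)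
    colourAt : ℕ → Bool
    colourAt zero = false
    colourAt (suc t) = ltb I (suc t) ∧ ltb t I'
    colour-old : ∀ x → colour (ι x) ≡ false
    colour-old x = cong [ (λ _ → false) , (λ t → ltb I (suc (toℕ t)) ∧ ltb (toℕ t) I') ]′ (FP.splitAt-↑ˡ n x m)
    colour-q : ∀ s → s ≤ suc m → colour (q s) ≡ colourAt s
    colour-q zero _ = colour-old u
    colour-q (suc t) (s≤s t≤m) with ℕP.m≤n⇒m<n∨m≡n t≤m
    ... | inj₂ refl rewrite q-last | colour-old w | ltb-false {m} {I'} (λ m<I' → ℕP.<⇒≱ m<I' I'≤m) = sym (BoolP.∧-zeroʳ _)
    ... | inj₁ t<m with q-middle t t<m
    ...   | t' , t'≡t , eq rewrite eq | FP.splitAt-↑ʳ n m t' | t'≡t = refl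
    colourAt-step : ∀ t → t ≢ I → t ≢ I' → colourAt t ≡ colourAt (suc t)
    colourAt-step zero t≢I t≢I' rewrite ltb-false {I} {1} (λ I<1 → t≢I (sym (ℕP.n<1⇒n≡0 I<1))) = refl
    colourAt-step (suc t) t≢I t≢I' = cong₂ _∧_ (sym (ltb-sucʳ (λ eq → t≢I (sym eq)))) (ltb-sucˡ t≢I')
    missing : ∀ k k' → P k ≡ true → P k' ≡ false → toℕ k ≢ toℕ k'
    missing k k' Pk Pk' eq with FP.toℕ-injective eq
    ... | refl = true⇒¬false Pk Pk'
    preserved : ∀ e' → mem (combine S P) e' → colour (proj₁ (lookup (edges G') e')) ≡ colour (proj₂ (lookup (edges G') e'))
    preserved e' = go e' (edgeKind e')
      where
      go : ∀ e' → EdgeKind e' → mem (combine S P) e' → colour (proj₁ (lookup (edges G') e')) ≡ colour (proj₂ (lookup (edges G') e'))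
      go _ (oldKind e) _ rewrite lookup-oldEdge e = trans (colour-old _) (sym (colour-old _))
      go _ (pathKind k) present rewrite lookup-pathEdge k | colour-q (toℕ k) (ℕP.<⇒≤ (toℕ<K k)) | colour-q (suc (toℕ k)) (toℕ<K k) =
        colourAt-step (toℕ k) (missing k i Pk Pi) (missing k i' Pk Pi')
        where
        Pk : P k ≡ true
        Pk = trans (sym (combine-path S P k)) present
    differ : colour (q (suc I)) ≢ colour (q 0)
    differ eq with trans (sym (colour-q (suc I) (ℕP.≤-trans (s≤s (ℕP.<⇒≤ i<i')) (s≤s I'≤m)))) (trans eq (colour-q 0 z≤n))
    ... | e rewrite ltb-true {I} {suc I} ℕP.≤-refl | ltb-true i<i' with e
    ...   | ()

-- Spanning trees of G' from spanning trees of G, where e₀ is an edge (u, w) of G: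
--  * S ∪ (path minus edge j) for a spanning tree S of G and 0 ≤ j ≤ m;
--  * (T minus e₀) ∪ (whole path) for a spanning tree T of G containing e₀;
-- and conversely every spanning tree of G' has exactly one of these forms.
module TreeCorrespondence (G : Graph) (u w : Fin (nv G)) (m : ℕ)
                          (e₀ : Fin (length (edges G))) (e₀≡uw : lookup (edges G) e₀ ≡ (u , w)) where
  open Connectivity G u w m public

  allBut : Fin K → Fin K → Bool
  allBut j i = not (eqᵇ i j)

  full : Fin K → Bool
  full _ = true

  allBut-self : ∀ i → allBut i i ≡ false
  allBut-self i = cong not (eqᵇ-refl i)

  allBut-other : ∀ {i j} → i ≢ j → allBut j i ≡ true
  allBut-other i≢j = cong not (eqᵇ-false i≢j)

  allBut-toℕ : ∀ {i j} → allBut j i ≡ true → toℕ i ≢ toℕ j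
  allBut-toℕ {i} {j} present eq = true⇒¬false present (trans (cong (allBut j) (FP.toℕ-injective eq)) (allBut-self j))

  withE₀ : Subset E → Subset E
  withE₀ S = V.tabulate (λ e → V.lookup S e ∨ eqᵇ e e₀)

  lookup-withE₀ : ∀ S e → V.lookup (withE₀ S) e ≡ V.lookup S e ∨ eqᵇ e e₀
  lookup-withE₀ S e = VP.lookup∘tabulate (λ e → V.lookup S e ∨ eqᵇ e e₀) e

  e₀∈withE₀ : ∀ S → mem (withE₀ S) e₀
  e₀∈withE₀ S = trans (lookup-withE₀ S e₀) (trans (cong (V.lookup S e₀ ∨_) (eqᵇ-refl e₀)) (BoolP.∨-zeroʳ _))

  withE₀-⊇ : ∀ S e → mem S e → mem (withE₀ S) e
  withE₀-⊇ S e p = trans (lookup-withE₀ S e) (cong (_∨ eqᵇ e e₀) p)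

  withE₀-∖ : ∀ S → V.lookup S e₀ ≡ false → withE₀ S ∖ e₀ ≡ S
  withE₀-∖ S e₀∉S = vecExt _ _ λ e → trans (lookup-∖ (withE₀ S) e₀ e) (trans (cong (_∧ not (eqᵇ e e₀)) (lookup-withE₀ S e)) (pointwise e))
    where
    pointwise : ∀ e → (V.lookup S e ∨ eqᵇ e e₀) ∧ not (eqᵇ e e₀) ≡ V.lookup S e
    pointwise e with e F.≟ e₀
    ... | yes refl rewrite e₀∉S = refl
    ... | no e≢e₀ = trans (BoolP.∧-identityʳ _) (BoolP.∨-identityʳ _)

  e₀-walk : ∀ {X : Subset E} → mem X e₀ → Reach G X u w
  e₀-walk {X} p = subst₂ (Reach G X) (cong proj₁ e₀≡uw) (cong proj₂ e₀≡uw) (edgeWalk G e₀ p)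

  j≤m : (j : Fin K) → toℕ j ≤ m
  j≤m j = ℕP.≤-pred (toℕ<K j)

  reachNew-full : ∀ S t → Σ (Fin n) λ x → Reach G' (combine S full) (n ↑ʳ t) (ι x)
  reachNew-full S t = u , walk-sym G' (subst (Reach G' (combine S full) (ι u)) (q-new t)
                            (pathWalk S full 0 (suc (toℕ t)) z≤n (ℕP.m≤n⇒m≤1+n (FP.toℕ<n t)) (λ _ _ _ → refl)))

  reachNew-allBut : ∀ S (j : Fin K) t → Σ (Fin n) λ x → Reach G' (combine S (allBut j)) (n ↑ʳ t) (ι x)
  reachNew-allBut S j t with suc (toℕ t) ℕ.≤? toℕ j
  ... | yes t<j = u , walk-sym G' (subst (Reach G' (combine S (allBut j)) (ι u)) (q-new t)
          (pathWalk S (allBut j) 0 (suc (toℕ t)) z≤n (ℕP.m≤n⇒m≤1+n (FP.toℕ<n t))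
             (λ i _ i<t → allBut-other (λ eq → ℕP.<⇒≢ (ℕP.<-≤-trans i<t t<j) (cong toℕ eq)))))
  ... | no t≮j = w , subst₂ (Reach G' (combine S (allBut j))) (q-new t) q-last
          (pathWalk S (allBut j) (suc (toℕ t)) (suc m) (ℕP.m≤n⇒m≤1+n (FP.toℕ<n t)) ℕP.≤-refl
             (λ i t<i _ → allBut-other (λ eq → t≮j (subst (suc (toℕ t) ℕ.≤_) (cong toℕ eq) t<i))))

  connected-allBut : ∀ S j → Connected G S → Connected G' (combine S (allBut j))
  connected-allBut S j conn = connected-up S S (allBut j) conn (oldEdgeWalk S (allBut j)) (reachNew-allBut S j)

  connected-allBut⁻ : ∀ S j → Connected G' (combine S (allBut j)) → Connected G S
  connected-allBut⁻ S j = Collapse.connected-down (toℕ j) (j≤m j) S S (allBut j) (λ e p → p)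
    (λ i present i≡j → ⊥-elim (allBut-toℕ present i≡j))

  -- connectivity with the full path, where e₀ may be replaced by the path
  connected-full : ∀ (X S : Subset E) → Connected G X → (∀ e → mem X e → e ≢ e₀ → mem S e) → Connected G' (combine S full)
  connected-full X S conn X⊆S∪e₀ = connected-up X S full conn lift (reachNew-full S)
    where
    fullWalk : Reach G' (combine S full) (ι u) (ι w)
    fullWalk = subst (Reach G' (combine S full) (ι u)) q-last (pathWalk S full 0 (suc m) z≤n ℕP.≤-refl (λ _ _ _ → refl))
    lift : ∀ e → mem X e → Reach G' (combine S full) (ι (proj₁ (lookup (edges G) e))) (ι (proj₂ (lookup (edges G) e)))
    lift e p with e F.≟ e₀
    ... | yes refl rewrite e₀≡uw = fullWalk
    ... | no e≢e₀ = oldEdgeWalk S full e (X⊆S∪e₀ e p e≢e₀)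

  connected-full⁻ : ∀ (X S : Subset E) → (∀ e → mem S e → mem X e) → mem X e₀ → Connected G' (combine S full) → Connected G X
  connected-full⁻ X S S⊆X e₀∈X = Collapse.connected-down m ℕP.≤-refl X S full S⊆X (λ _ _ _ → e₀-walk e₀∈X)

  full∖path : ∀ S i → combine S full ∖ pathEdge i ≡ combine S (allBut i)
  full∖path S i = trans (combine-∖-path S full i) (combine-cong S _ _ (λ i' → refl))

  -- S ∪ (path minus j) is a spanning tree iff S is: removing an old edge
  -- disconnects by minimality of S, removing a second path edge by twoMissing
  tree-allBut : ∀ S j → IsSpanningTree G S → IsSpanningTree G' (combine S (allBut j))
  tree-allBut S j (conn , minimal) = connected-allBut S j conn , λ e' e'∈ → go e' (edgeKind e') (∈⇒mem e'∈)
    where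
    go : ∀ e' → EdgeKind e' → mem (combine S (allBut j)) e' → ¬ Connected G' (combine S (allBut j) ∖ e')
    go _ (oldKind e) present c = minimal e (mem⇒∈ (trans (sym (combine-old S (allBut j) e)) present))
      (connected-allBut⁻ (S ∖ e) j (subst (Connected G') (combine-∖-old S (allBut j) e) c))
    go _ (pathKind i) present c with ℕP.<-cmp (toℕ i) (toℕ j)
    ... | tri≈ _ i≡j _ = allBut-toℕ (trans (sym (combine-path S (allBut j) i)) present) i≡j
    ... | tri< i<j _ _ = twoMissing S P₂ i j P₂-i P₂-j i<j (subst (Connected G') (combine-∖-path S (allBut j) i) c)
      where
      P₂ : Fin K → Bool
      P₂ i' = allBut j i' ∧ not (eqᵇ i' i)
      P₂-i : P₂ i ≡ false
      P₂-i = trans (cong (λ b → allBut j i ∧ not b) (eqᵇ-refl i)) (BoolP.∧-zeroʳ _)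
      P₂-j : P₂ j ≡ false
      P₂-j = cong (_∧ not (eqᵇ j i)) (allBut-self j)
    ... | tri> _ _ i>j = twoMissing S P₂ j i P₂-j P₂-i i>j (subst (Connected G') (combine-∖-path S (allBut j) i) c)
      where
      P₂ : Fin K → Bool
      P₂ i' = allBut j i' ∧ not (eqᵇ i' i)
      P₂-i : P₂ i ≡ false
      P₂-i = trans (cong (λ b → allBut j i ∧ not b) (eqᵇ-refl i)) (BoolP.∧-zeroʳ _)
      P₂-j : P₂ j ≡ false
      P₂-j = cong (_∧ not (eqᵇ j i)) (allBut-self j)

  tree-allBut⁻ : ∀ S j → IsSpanningTree G' (combine S (allBut j)) → IsSpanningTree G S
  tree-allBut⁻ S j (conn , minimal) = connected-allBut⁻ S j conn , λ e e∈S c →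
    minimal (oldEdge e) (mem⇒∈ (trans (combine-old S (allBut j) e) (∈⇒mem e∈S)))
            (subst (Connected G') (sym (combine-∖-old S (allBut j) e)) (connected-allBut (S ∖ e) j c))

  tree-full : ∀ T → IsSpanningTree G T → mem T e₀ → IsSpanningTree G' (combine (T ∖ e₀) full)
  tree-full T (conn , minimal) e₀∈T =
    connected-full T (T ∖ e₀) conn (λ e p e≢e₀ → ∖-keep {S = T} p e≢e₀) , λ e' e'∈ → go e' (edgeKind e') (∈⇒mem e'∈)
    where
    go : ∀ e' → EdgeKind e' → mem (combine (T ∖ e₀) full) e' → ¬ Connected G' (combine (T ∖ e₀) full ∖ e')
    go _ (oldKind e) present c = minimal e (mem⇒∈ (∖-⊆ {S = T} e∈T∖e₀))
      (connected-full⁻ (T ∖ e) ((T ∖ e₀) ∖ e) shrink (∖-keep {S = T} e₀∈T (λ eq → e≢e₀ (sym eq)))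
         (subst (Connected G') (combine-∖-old (T ∖ e₀) full e) c))
      where
      e∈T∖e₀ : mem (T ∖ e₀) e
      e∈T∖e₀ = trans (sym (combine-old (T ∖ e₀) full e)) present
      e≢e₀ : e ≢ e₀
      e≢e₀ refl = true⇒¬false e∈T∖e₀ (∖-removed T e₀)
      shrink : ∀ e' → mem ((T ∖ e₀) ∖ e) e' → mem (T ∖ e) e'
      shrink e' p = ∖-keep {S = T} (∖-⊆ {S = T} (∖-⊆ {S = T ∖ e₀} p)) (λ { refl → true⇒¬false p (∖-removed (T ∖ e₀) e') })
    go _ (pathKind i) present c = minimal e₀ (mem⇒∈ e₀∈T)
      (Collapse.connected-down (toℕ i) (j≤m i) (T ∖ e₀) (T ∖ e₀) (allBut i) (λ e p → p)
        (λ i' present' i'≡i → ⊥-elim (allBut-toℕ present' i'≡i))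
        (subst (Connected G') (full∖path (T ∖ e₀) i) c))

  module FromFullPath (S : Subset E) (tree : IsSpanningTree G' (combine S full)) where
    S-disconnected : ¬ Connected G S
    S-disconnected connS = proj₂ tree (pathEdge lastEdge) (mem⇒∈ (combine-path S full lastEdge))
      (subst (Connected G') (sym (full∖path S lastEdge)) (connected-allBut S lastEdge connS))
      where
      lastEdge : Fin K
      lastEdge = pathIndex m ℕP.≤-refl

    e₀∉S : V.lookup S e₀ ≡ false
    e₀∉S with V.lookup S e₀ in e₀∈S
    ... | false = refl
    ... | true = ⊥-elim (S-disconnected (connected-full⁻ S S (λ e p → p) e₀∈S (proj₁ tree)))

    connected : Connected G (withE₀ S)
    connected = connected-full⁻ (withE₀ S) S (withE₀-⊇ S) (e₀∈withE₀ S) (proj₁ tree)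

    minimal : ∀ e → e ∈ withE₀ S → ¬ Connected G (withE₀ S ∖ e)
    minimal e e∈ c with e F.≟ e₀
    ... | yes refl = S-disconnected (subst (Connected G) (withE₀-∖ S e₀∉S) c)
    ... | no e≢e₀ = proj₂ tree (oldEdge e) (mem⇒∈ (trans (combine-old S full e) e∈S))
                      (subst (Connected G') (sym (combine-∖-old S full e)) (connected-full (withE₀ S ∖ e) (S ∖ e) c shrink))
      where
      withE₀-e : ∀ e' → e' ≢ e₀ → V.lookup (withE₀ S) e' ≡ V.lookup S e'
      withE₀-e e' e'≢e₀ = trans (lookup-withE₀ S e') (trans (cong (V.lookup S e' ∨_) (eqᵇ-false e'≢e₀)) (BoolP.∨-identityʳ _))
      e∈S : mem S e
      e∈S = trans (sym (withE₀-e e e≢e₀)) (∈⇒mem e∈)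
      shrink : ∀ e' → mem (withE₀ S ∖ e) e' → e' ≢ e₀ → mem (S ∖ e) e'
      shrink e' p e'≢e₀ = trans (lookup-∖ S e e')
        (trans (cong (_∧ not (eqᵇ e' e)) (sym (withE₀-e e' e'≢e₀))) (trans (sym (lookup-∖ (withE₀ S) e e')) p))

    tree-withE₀ : IsSpanningTree G (withE₀ S)
    tree-withE₀ = connected , minimal

-- Adding a path of m+1 edges at an edge e₀ of P
-- gives (m+1) a + b trees (m+1 blocks of a, plus b for the trees through e₀),
-- of which m a + b contain a given new path edge.

containing : ∀ {E} (e : Fin E) → List (Subset E) → List (Subset E)
containing e = filter (λ S → V.lookup S e Bool.≟ true)

record TreeInvariant (G : Graph) (P : List (Fin (nv G))) (a b : ℕ) : Set where
  field
    trees : List (Subset (length (edges G)))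
    unique : Unique trees
    all-trees : All (IsSpanningTree G) trees
    complete : ∀ S → IsSpanningTree G S → S LM.∈ trees
    count : length trees ≡ a
    edgeCount : ∀ j x y → adjPair P j ≡ just (x , y) →
      Σ (Fin (length (edges G))) λ e → (lookup (edges G) e ≡ (x , y)) × (length (containing e trees) ≡ b)

module _ {A : Set} where
  length-concat : (xss : List (List A)) → length (concat xss) ≡ sum (map length xss)
  length-concat [] = refl
  length-concat (xs ∷ xss) = trans (LP.length-++ xs) (cong (length xs ℕ.+_) (length-concat xss))

  length-filter-concat : ∀ {P : A → Set} (P? : ∀ x → Dec (P x)) (xss : List (List A)) →
    length (filter P? (concat xss)) ≡ sum (map (λ xs → length (filter P? xs)) xss)
  length-filter-concat P? [] = refl
  length-filter-concat P? (xs ∷ xss) = trans (cong length (LP.filter-++ P? xs (concat xss)))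
    (trans (LP.length-++ (filter P? xs)) (cong (length (filter P? xs) ℕ.+_) (length-filter-concat P? xss)))

  unique-map-on : {B : Set} (f : A → B) (xs : List A) → Unique xs →
    (∀ {x y} → x LM.∈ xs → y LM.∈ xs → f x ≡ f y → x ≡ y) → Unique (map f xs)
  unique-map-on f [] _ _ = AllPairs.[]
  unique-map-on f (x ∷ xs) (x∉ AllPairs.∷ u) inj =
    AllP.map⁺ (All.tabulate (λ {y} y∈ eq → All.lookup x∉ y∈ (inj (Any.here refl) (Any.there y∈) eq)))
    AllPairs.∷ unique-map-on f xs u (λ p p' eq → inj (Any.there p) (Any.there p') eq)

sumFin : ∀ K → (Fin K → ℕ) → ℕ
sumFin zero f = 0
sumFin (suc K) f = f F.zero ℕ.+ sumFin K (λ i → f (F.suc i))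

sum-allFin : ∀ K (f : Fin K → ℕ) → sum (map f (allFin K)) ≡ sumFin K f
sum-allFin K f = trans (cong sum (LP.map-tabulate (λ x → x) f)) (go K f)
  where
  go : ∀ K (f : Fin K → ℕ) → sum (tabulate f) ≡ sumFin K f
  go zero f = refl
  go (suc K) f = cong (f F.zero ℕ.+_) (go K (λ i → f (F.suc i)))

sumFin-const : ∀ K (f : Fin K → ℕ) a → (∀ i → f i ≡ a) → sumFin K f ≡ K ℕ.* a
sumFin-const zero f a h = refl
sumFin-const (suc K) f a h = cong₂ ℕ._+_ (h F.zero) (sumFin-const K (λ i → f (F.suc i)) a (λ i → h (F.suc i)))

sumFin-except : ∀ K (i₀ : Fin K) (f : Fin K → ℕ) a → f i₀ ≡ 0 → (∀ i → i ≢ i₀ → f i ≡ a) → sumFin K f ≡ (K ∸ 1) ℕ.* a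
sumFin-except (suc K) F.zero f a f0 h =
  trans (cong (ℕ._+ sumFin K (λ i → f (F.suc i))) f0) (sumFin-const K (λ i → f (F.suc i)) a (λ i → h (F.suc i) (λ ())))
sumFin-except (suc (suc K)) (F.suc i₀) f a f0 h =
  cong₂ ℕ._+_ (h F.zero (λ ())) (sumFin-except (suc K) i₀ (λ i → f (F.suc i)) a f0 (λ i i≢ → h (F.suc i) (λ eq → i≢ (FP.suc-injective eq))))

trees-pc0 : TreeInvariant (graph pc0) (path pc0) 1 1
trees-pc0 = record
  { trees = edge ∷ [] ; unique = [] AllPairs.∷ AllPairs.[] ; all-trees = edge-tree ∷ []
  ; complete = complete ; count = refl ; edgeCount = edgeCount }
  where
  G₀ : Graph
  G₀ = graph pc0
  edge : Subset 1
  edge = true ∷ []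
  disconnected : ∀ (S : Subset 1) → V.lookup S F.zero ≡ false → ¬ Connected G₀ S
  disconnected S absent conn with colour-invariant G₀ {S} (λ v → eqᵇ v F.zero)
                                    (λ { F.zero present → ⊥-elim (true⇒¬false present absent) }) (conn F.zero (F.suc F.zero))
  ... | ()
  connected : Connected G₀ edge
  connected F.zero F.zero = here
  connected F.zero (F.suc F.zero) = edgeWalk G₀ F.zero refl
  connected (F.suc F.zero) F.zero = walk-sym G₀ (edgeWalk G₀ {edge} F.zero refl)
  connected (F.suc F.zero) (F.suc F.zero) = here
  edge-tree : IsSpanningTree G₀ edge
  edge-tree = connected , λ { F.zero _ → disconnected (edge ∖ F.zero) refl }
  complete : ∀ S → IsSpanningTree G₀ S → S LM.∈ (edge ∷ [])
  complete (true ∷ []) _ = Any.here refl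
  complete (false ∷ []) (conn , _) = ⊥-elim (disconnected (false ∷ []) refl conn)
  edgeCount : ∀ j x y → adjPair (path pc0) j ≡ just (x , y) →
    Σ (Fin 1) λ e → (lookup (edges G₀) e ≡ (x , y)) × (length (containing e (edge ∷ [])) ≡ 1)
  edgeCount zero x y refl = F.zero , refl , refl
  edgeCount (suc zero) x y ()
  edgeCount (suc (suc j)) x y ()

module TreeStep (G : Graph) (P : List (Fin (nv G))) (a b : ℕ) (I : TreeInvariant G P a b)
                (J : ℕ) (u w : Fin (nv G)) (uw∈P : adjPair P J ≡ just (u , w)) (m : ℕ) where
  open TreeInvariant I

  e₀ : Fin (length (edges G))
  e₀ = proj₁ (edgeCount J u w uw∈P)

  open TreeCorrespondence G u w m e₀ (proj₁ (proj₂ (edgeCount J u w uw∈P))) public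

  through-e₀ : List (Subset E)
  through-e₀ = containing e₀ trees

  block : Fin K → List (Subset E')
  block j = map (λ S → combine S (allBut j)) trees

  blocks : List (Subset E')
  blocks = concat (map block (allFin K))

  fullPath : List (Subset E')
  fullPath = map (λ T → combine (T ∖ e₀) full) through-e₀

  trees' : List (Subset E')
  trees' = blocks ++ fullPath

  ∈blocks : ∀ {S'} → S' LM.∈ blocks → Σ (Fin K) λ j → Σ (Subset E) λ S → (S LM.∈ trees) × (S' ≡ combine S (allBut j))
  ∈blocks S'∈ with LMP.∈-concat⁻′ (map block (allFin K)) S'∈
  ... | xs , S'∈xs , xs∈ with LMP.∈-map⁻ block xs∈
  ...   | j , _ , refl with LMP.∈-map⁻ (λ S → combine S (allBut j)) S'∈xs
  ...     | S , S∈ , eq = j , S , S∈ , eq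

  ∈fullPath : ∀ {S'} → S' LM.∈ fullPath → Σ (Subset E) λ T → (T LM.∈ through-e₀) × (S' ≡ combine (T ∖ e₀) full)
  ∈fullPath = LMP.∈-map⁻ (λ T → combine (T ∖ e₀) full)

  ∈through-e₀ : ∀ {T} → T LM.∈ through-e₀ → (T LM.∈ trees) × mem T e₀
  ∈through-e₀ = LMP.∈-filter⁻ (λ S → V.lookup S e₀ Bool.≟ true) {xs = trees}

  all-trees' : All (IsSpanningTree G') trees'
  all-trees' = All.tabulate λ S'∈ → go (LMP.∈-++⁻ blocks S'∈)
    where
    go : ∀ {S'} → (S' LM.∈ blocks) ⊎ (S' LM.∈ fullPath) → IsSpanningTree G' S'
    go (inj₁ p) with ∈blocks p
    ... | j , S , S∈ , refl = tree-allBut S j (All.lookup all-trees S∈)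
    go (inj₂ p) with ∈fullPath p
    ... | T , T∈ , refl = tree-full T (All.lookup all-trees (proj₁ (∈through-e₀ T∈))) (proj₂ (∈through-e₀ T∈))

  fullPath-injective : ∀ {T T'} → T LM.∈ through-e₀ → T' LM.∈ through-e₀ → combine (T ∖ e₀) full ≡ combine (T' ∖ e₀) full → T ≡ T'
  fullPath-injective {T} {T'} T∈ T'∈ eq = vecExt T T' pointwise
    where
    same : T ∖ e₀ ≡ T' ∖ e₀
    same = proj₁ (combine-injective {T ∖ e₀} {full} {T' ∖ e₀} {full} eq)
    pointwise : ∀ e → V.lookup T e ≡ V.lookup T' e
    pointwise e with e F.≟ e₀
    ... | yes refl = trans (proj₂ (∈through-e₀ T∈)) (sym (proj₂ (∈through-e₀ T'∈)))
    ... | no e≢e₀ = trans (sym (keep T)) (trans (sym (lookup-∖ T e₀ e)) (trans (cong (λ X → V.lookup X e) same)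
                      (trans (lookup-∖ T' e₀ e) (keep T'))))
      where
      keep : ∀ X → V.lookup X e ∧ not (eqᵇ e e₀) ≡ V.lookup X e
      keep X = trans (cong (λ b → V.lookup X e ∧ not b) (eqᵇ-false e≢e₀)) (BoolP.∧-identityʳ _)

  unique' : Unique trees'
  unique' = UniqueP.++⁺ (UniqueP.concat⁺ blocks-unique blocks-disjoint) fullPath-unique blocks-fullPath-disjoint
    where
    blocks-unique : All Unique (map block (allFin K))
    blocks-unique = AllP.map⁺ (All.universal (λ j → UniqueP.map⁺ (λ eq → proj₁ (combine-injective eq)) unique) (allFin K))
    disjoint : ∀ {j j'} → j ≢ j' → Disjoint (block j) (block j')
    disjoint {j} {j'} j≢j' (p , p') with LMP.∈-map⁻ (λ S → combine S (allBut j)) p | LMP.∈-map⁻ (λ S → combine S (allBut j')) p'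
    ... | S , _ , eq | S₂ , _ , eq' =
      true⇒¬false (allBut-other j≢j') (trans (sym (proj₂ (combine-injective {S} {allBut j} {S₂} {allBut j'} (trans (sym eq) eq')) j)) (allBut-self j))
    blocks-disjoint : AllPairs Disjoint (map block (allFin K))
    blocks-disjoint = AllPairsP.map⁺ (AllPairs.map disjoint (UniqueP.allFin⁺ K))
    fullPath-unique : Unique fullPath
    fullPath-unique = unique-map-on (λ T → combine (T ∖ e₀) full) through-e₀ (UniqueP.filter⁺ (λ S → V.lookup S e₀ Bool.≟ true) unique) fullPath-injective
    blocks-fullPath-disjoint : Disjoint blocks fullPath
    blocks-fullPath-disjoint (p , p') with ∈blocks p | ∈fullPath p'
    ... | j , S , _ , eq | T , _ , eq' =
      true≢false (trans (proj₂ (combine-injective {T ∖ e₀} {full} {S} {allBut j} (trans (sym eq') eq)) j) (allBut-self j))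

  complete-full : ∀ S' → IsSpanningTree G' S' → (∀ i → pathPart S' i ≡ true) → S' LM.∈ fullPath
  complete-full S' tree noneMissing = subst (LM._∈ fullPath) (sym S'≡) (LMP.∈-map⁺ (λ T → combine (T ∖ e₀) full) T∈)
    where
    S : Subset E
    S = oldPart S'
    S'≡full : S' ≡ combine S full
    S'≡full = trans (decompose S') (combine-cong S _ _ noneMissing)
    open FromFullPath S (subst (IsSpanningTree G') S'≡full tree)
    S'≡ : S' ≡ combine (withE₀ S ∖ e₀) full
    S'≡ = trans S'≡full (cong (λ X → combine X full) (sym (withE₀-∖ S e₀∉S)))
    T∈ : withE₀ S LM.∈ through-e₀
    T∈ = LMP.∈-filter⁺ (λ S → V.lookup S e₀ Bool.≟ true) (complete (withE₀ S) tree-withE₀) (e₀∈withE₀ S)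

  complete-block : ∀ S' j → IsSpanningTree G' S' → (∀ i → pathPart S' i ≡ allBut j i) → S' LM.∈ blocks
  complete-block S' j tree onlyJ =
    LMP.∈-concat⁺′ (subst (LM._∈ block j) (sym S'≡) (LMP.∈-map⁺ (λ S → combine S (allBut j)) S∈)) (LMP.∈-map⁺ block (LMP.∈-allFin j))
    where
    S : Subset E
    S = oldPart S'
    S'≡ : S' ≡ combine S (allBut j)
    S'≡ = trans (decompose S') (combine-cong S _ _ onlyJ)
    S∈ : S LM.∈ trees
    S∈ = complete S (tree-allBut⁻ S j (subst (IsSpanningTree G') S'≡ tree))

  -- every spanning tree of G' occurs: it misses no path edge, or exactly one
  -- (missing two would disconnect it)
  complete' : ∀ S' → IsSpanningTree G' S' → S' LM.∈ trees'
  complete' S' tree with FP.any? (λ i → pathPart S' i Bool.≟ false)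
  ... | no noneMissing = LMP.∈-++⁺ʳ blocks (complete-full S' tree (λ i → ¬false⇒true (λ p → noneMissing (i , p))))
  ... | yes (j , j-missing) with FP.any? (λ i → ¬? (i F.≟ j) ×-dec (pathPart S' i Bool.≟ false))
  ...   | yes (i , i≢j , i-missing) = ⊥-elim (twoDifferent (ℕP.<-cmp (toℕ i) (toℕ j)))
    where
    conn : Connected G' (combine (oldPart S') (pathPart S'))
    conn = subst (Connected G') (decompose S') (proj₁ tree)
    twoDifferent : Tri (toℕ i < toℕ j) (toℕ i ≡ toℕ j) (toℕ j < toℕ i) → ⊥
    twoDifferent (tri< i<j _ _) = twoMissing (oldPart S') (pathPart S') i j i-missing j-missing i<j conn
    twoDifferent (tri≈ _ i≡j _) = i≢j (FP.toℕ-injective i≡j)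
    twoDifferent (tri> _ _ i>j) = twoMissing (oldPart S') (pathPart S') j i j-missing i-missing i>j conn
  ...   | no onlyJ = LMP.∈-++⁺ˡ (complete-block S' j tree pathPart≡)
    where
    pathPart≡ : ∀ i → pathPart S' i ≡ allBut j i
    pathPart≡ i with i F.≟ j
    ... | yes refl = j-missing
    ... | no i≢j = ¬false⇒true (λ p → onlyJ (i , i≢j , p))

  count' : length trees' ≡ suc m ℕ.* a ℕ.+ b
  count' = trans (LP.length-++ blocks) (cong₂ ℕ._+_ blocksCount (trans (LP.length-map _ through-e₀) (proj₂ (proj₂ (edgeCount J u w uw∈P)))))
    where
    blocksCount : length blocks ≡ suc m ℕ.* a
    blocksCount = begin
        length blocks
      ≡⟨ length-concat (map block (allFin K)) ⟩
        sum (map length (map block (allFin K)))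
      ≡⟨ cong sum (sym (LP.map-∘ (allFin K))) ⟩
        sum (map (λ j → length (block j)) (allFin K))
      ≡⟨ sum-allFin K (λ j → length (block j)) ⟩
        sumFin K (λ j → length (block j))
      ≡⟨ sumFin-const K _ a (λ j → trans (LP.length-map _ trees) count) ⟩
        K ℕ.* a
      ≡⟨ cong (ℕ._* a) K≡ ⟩
        suc m ℕ.* a
      ∎
      where open ≡-Reasoning

  -- path edge i₀ lies in every tree except those of block i₀
  pathEdgeCount : ∀ i₀ → length (containing (pathEdge i₀) trees') ≡ m ℕ.* a ℕ.+ b
  pathEdgeCount i₀ = trans (cong length (LP.filter-++ present? blocks fullPath))
    (trans (LP.length-++ (filter present? blocks)) (cong₂ ℕ._+_ inBlocks inFullPath))
    where
    present? : (S : Subset E') → Dec (V.lookup S (pathEdge i₀) ≡ true)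
    present? S = V.lookup S (pathEdge i₀) Bool.≟ true
    perBlock : ∀ j → length (filter present? (block j)) ≡ (if eqᵇ j i₀ then 0 else a)
    perBlock j with j F.≟ i₀
    ... | yes refl = cong length (LP.filter-none present? (AllP.map⁺ (All.universal (λ S present →
          true≢false (trans (sym present) (trans (combine-path S (allBut i₀) i₀) (allBut-self i₀)))) trees)))
    ... | no j≢i₀ = trans (cong length (LP.filter-all present? (AllP.map⁺ (All.universal (λ S →
          trans (combine-path S (allBut j) i₀) (allBut-other (λ eq → j≢i₀ (sym eq)))) trees)))) (trans (LP.length-map _ trees) count)
    inBlocks : length (filter present? blocks) ≡ m ℕ.* a
    inBlocks = begin
        length (filter present? blocks)
      ≡⟨ length-filter-concat present? (map block (allFin K)) ⟩
        sum (map (λ xs → length (filter present? xs)) (map block (allFin K)))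
      ≡⟨ cong sum (sym (LP.map-∘ (allFin K))) ⟩
        sum (map (λ j → length (filter present? (block j))) (allFin K))
      ≡⟨ sum-allFin K _ ⟩
        sumFin K (λ j → length (filter present? (block j)))
      ≡⟨ sumFin-except K i₀ _ a (trans (perBlock i₀) (cong (λ b → if b then 0 else a) (eqᵇ-refl i₀)))
                                (λ j j≢i₀ → trans (perBlock j) (cong (λ b → if b then 0 else a) (eqᵇ-false j≢i₀))) ⟩
        (K ∸ 1) ℕ.* a
      ≡⟨ cong (λ k → (k ∸ 1) ℕ.* a) K≡ ⟩
        m ℕ.* a
      ∎
      where open ≡-Reasoning
    inFullPath : length (filter present? fullPath) ≡ b
    inFullPath = trans (cong length (LP.filter-all present? (AllP.map⁺ (All.universal (λ T → combine-path (T ∖ e₀) full i₀) through-e₀))))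
                       (trans (LP.length-map _ through-e₀) (proj₂ (proj₂ (edgeCount J u w uw∈P))))

  edgeCount' : ∀ j x y → adjPair L j ≡ just (x , y) →
    Σ (Fin E') λ e → (lookup (edges G') e ≡ (x , y)) × (length (containing e trees') ≡ m ℕ.* a ℕ.+ b)
  edgeCount' j x y xy∈L with adjPair-sound L (u ↑ˡ m) j x y xy∈L
  ... | refl , refl , j< = pathEdge i₀ , trans (lookup-pathEdge i₀) (cong (λ t → (q t , q (suc t))) (toℕ-pathIndex j j<m)) , pathEdgeCount i₀
    where
    j<m : j < suc m
    j<m = s≤s (adjPair-path-bound j<)
    i₀ : Fin K
    i₀ = pathIndex j j<m

  invariant' : TreeInvariant G' L (suc m ℕ.* a ℕ.+ b) (m ℕ.* a ℕ.+ b)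
  invariant' = record
    { trees = trees' ; unique = unique' ; all-trees = all-trees' ; complete = complete'
    ; count = count' ; edgeCount = edgeCount' }

ContinuantPair : List ℕ → ℕ → ℕ → Set
ContinuantPair ks a b = (+ a ≡ continuant ks) × (+ (a ∸ b) ≡ continuant⁻ ks) × (b ≤ a)

pos-∸ : ∀ a b → b ≤ a → + (a ∸ b) ≡ + a - + b
pos-∸ a b b≤a = sym (trans (ℤP.m-n≡m⊖n a b) (ℤP.⊖-≥ b≤a))

continuant-update : ∀ ks m a b → ContinuantPair ks a b →
  ContinuantPair (ks ++ [ suc (suc m) ]) (suc m ℕ.* a ℕ.+ b) (m ℕ.* a ℕ.+ b)
continuant-update ks m a b (a≡ , a-b≡ , b≤a) = numerator , initial , ≤-step
  where
  a'≡b'+a : suc m ℕ.* a ℕ.+ b ≡ (m ℕ.* a ℕ.+ b) ℕ.+ a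
  a'≡b'+a = rearrange m a b
    where
    rearrange : ∀ m a b → suc m ℕ.* a ℕ.+ b ≡ m ℕ.* a ℕ.+ b ℕ.+ a
    rearrange = ℕSolver.solve-∀
  numerator : + (suc m ℕ.* a ℕ.+ b) ≡ continuant (ks ++ [ suc (suc m) ])
  numerator = sym (begin
      continuant (ks ++ [ suc (suc m) ])
    ≡⟨ continuant-snoc ks (suc (suc m)) ⟩
      + suc (suc m) * continuant ks - continuant⁻ ks
    ≡⟨ cong₂ (λ x y → + suc (suc m) * x - y) (sym a≡) (trans (sym a-b≡) (pos-∸ a b b≤a)) ⟩
      + suc (suc m) * + a - (+ a - + b)
    ≡⟨ regroup (+ m) (+ a) (+ b) ⟩
      + suc m * + a + + b
    ≡⟨ sym (trans (ℤP.pos-+ (suc m ℕ.* a) b) (cong (_+ + b) (ℤP.pos-* (suc m) a))) ⟩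
      + (suc m ℕ.* a ℕ.+ b)
    ∎)
    where
    open ≡-Reasoning
    regroup : ∀ m a b → (+ 1 + (+ 1 + m)) * a - (a - b) ≡ (+ 1 + m) * a + b
    regroup = solve-∀
  initial : + ((suc m ℕ.* a ℕ.+ b) ∸ (m ℕ.* a ℕ.+ b)) ≡ continuant⁻ (ks ++ [ suc (suc m) ])
  initial = trans (cong +_ (trans (cong (_∸ (m ℕ.* a ℕ.+ b)) a'≡b'+a) (ℕP.m+n∸m≡n (m ℕ.* a ℕ.+ b) a)))
                  (trans a≡ (sym (continuant⁻-snoc ks (suc (suc m)))))
  ≤-step : m ℕ.* a ℕ.+ b ≤ suc m ℕ.* a ℕ.+ b
  ≤-step = subst (m ℕ.* a ℕ.+ b ≤_) (sym a'≡b'+a) (ℕP.m≤m+n _ a)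

record ChainInvariant (ks : List ℕ) (P : PCState) : Set where
  field
    a b : ℕ
    sandpile : SandpileInvariant (graph P) (path P) a b
    spanning : TreeInvariant (graph P) (path P) a b
    continuants : ContinuantPair ks a b

chainInvariant : ∀ ks P → All (2 ≤_) ks → IsPolygonChain ks P → ChainInvariant ks P
chainInvariant .[] .pc0 _ base = record
  { a = 1 ; b = 1 ; sandpile = sandpile-pc0 ; spanning = trees-pc0 ; continuants = refl , refl , ℕP.≤-refl }
chainInvariant .(ks ++ [ k ]) .(addPath P u w k) all≥2 (step {ks} {P} k J {u} {w} chain uw∈P)
  with AllP.++⁻ʳ ks all≥2
... | s≤s (s≤s {n = m} _) ∷ [] = record
  { a = suc m ℕ.* a ℕ.+ b ; b = m ℕ.* a ℕ.+ b
  ; sandpile = SandpileStep.invariant' (graph P) (path P) a b sandpile J u w uw∈P m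
  ; spanning = TreeStep.invariant' (graph P) (path P) a b spanning J u w uw∈P m
  ; continuants = continuant-update ks m a b continuants }
  where
  open ChainInvariant (chainInvariant ks P (AllP.++⁻ˡ ks all≥2) chain)

mainTheorem3 : (ks : List ℕ) (P : PCState) → All (2 ≤_) ks → IsPolygonChain ks P →
    Σ ℕ (λ N → NumSpanningTrees (graph P) N × SandpileCyclicOfOrder (graph P) N
    × (+ N ≡ matchingFormula ks))
mainTheorem3 ks P all≥2 chain =
  a , (trees , unique , all-trees , complete , count) , cyclic-of-order (certificate sandpile) ,
  trans (proj₁ continuants) (sym (matchingFormula≡continuant ks))
  where
  open ChainInvariant (chainInvariant ks P all≥2 chain)
  open TreeInvariant spanning
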